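{- Let $p$ be an odd prime and $a,b,c,k\in\mathbb{Z}$ with $k\ge0$ and $(c,p)=1$. Let $\zeta$ be a primitive $p^k$-th root of unity, let $f\in(\mathbb{Z}/p^k\mathbb{Z})[t]$, and define $g:\mathbb{Z}/p^k\mathbb{Z}\to\mathbb{Z}/p^k\mathbb{Z}$ by $g(t)=a+bt+ct^2+pf(t)$. Then $$\mathrm{Norm}_{\mathbb{Q}(\zeta)/\mathbb{Q}}\Big(\sum_{t=0}^{p^k-1}\zeta^{g(t)}\Big)=\mathrm{Norm}_{\mathbb{Q}(\zeta)/\mathbb{Q}}\Big(\sum_{t=0}^{p^k-1}\zeta^{t^2}\Big)=p^{\frac12 k[\mathbb{Q}(\zeta):\mathbb{Q}]}=p^{\frac12 k(p-1)p^{k-1}}.$$ -}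

module Defs where

open import Data.Nat as ℕ using (ℕ; zero; suc)
open import Data.Nat.GCD using (gcd)
open import Data.Integer as ℤ using (ℤ; +_; _%ℕ_)
open import Data.List using (List; []; _∷_; map; foldr; upTo; filterᵇ; replicate; _++_)
open import Data.Product using (∃)
open import Relation.Binary.PropositionalEquality using (_≡_)

-- Polynomials in ℤ[x] as coefficient lists, lowest degree first.
-- Trailing zeros are allowed; equality of polynomials is coefficientwise.
Poly : Set
Poly = List ℤ

coeff : Poly → ℕ → ℤ
coeff []       _       = + 0
coeff (a ∷ as) zero    = a
coeff (a ∷ as) (suc i) = coeff as i

infixl 6 _+P_
infixl 7 _*P_ _·P_

_+P_ : Poly → Poly → Poly
[]       +P q        = q
(a ∷ as) +P []       = a ∷ as
(a ∷ as) +P (b ∷ bs) = (a ℤ.+ b) ∷ (as +P bs)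

_·P_ : ℤ → Poly → Poly
c ·P q = map (c ℤ.*_) q

_*P_ : Poly → Poly → Poly
[]       *P q = []
(a ∷ as) *P q = (a ·P q) +P (+ 0 ∷ (as *P q))

_≈P_ : Poly → Poly → Set
P ≈P Q = ∀ i → coeff P i ≡ coeff Q i

monomial : ℕ → ℤ → Poly
monomial e c = replicate e (+ 0) ++ (c ∷ [])

xpow : ℕ → Poly
xpow j = monomial j (+ 1)

substPow : ℕ → Poly → Poly
substPow j []       = []
substPow j (a ∷ as) = (a ∷ []) +P (xpow j *P substPow j as)

sumP : List Poly → Poly
sumP = foldr _+P_ []

prodP : List Poly → Poly
prodP = foldr _*P_ (+ 1 ∷ [])

-- The cyclotomic polynomial Φ_{p^k}(x) of the primitive p^k-th roots of unity
-- (for p prime):  Φ_1 = x - 1,  Φ_{p^(k+1)} = Σ_{i<p} x^(i p^k).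
cyclotomicPP : ℕ → ℕ → Poly
cyclotomicPP p zero    = ℤ.- (+ 1) ∷ + 1 ∷ []
cyclotomicPP p (suc k) = sumP (map (λ i → xpow (i ℕ.* p ℕ.^ k)) (upTo p))

evalZ : Poly → ℤ → ℤ
evalZ []       t = + 0
evalZ (a ∷ as) t = a ℤ.+ t ℤ.* evalZ as t

-- z mod n as a natural number in [0,n) (n = 0 never occurs in use).
modN : ℤ → ℕ → ℕ
modN z zero    = 0
modN z (suc m) = z %ℕ suc m

-- Q(ζ) with ζ a primitive n-th root of unity is ℤ[x]/(Φ_n) ⊗ ℚ; an element
-- of ℤ[ζ] is represented by a polynomial h with h(ζ) the element.
-- The Galois automorphisms are σ_j : ζ ↦ ζ^j for 0 ≤ j < n, gcd(j,n) = 1,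
-- so Norm(h(ζ)) = ∏_j h(ζ^j).  "IsNormPP p k h N" says
-- Norm_{Q(ζ)/Q}(h(ζ)) = N for ζ a primitive p^k-th root of unity, i.e.
-- ∏_j h(x^j) ≡ N  (mod Φ_{p^k}) in ℤ[x].
galoisExps : ℕ → List ℕ
galoisExps n = filterᵇ (λ j → gcd j n ℕ.≡ᵇ 1) (upTo n)

normProd : ℕ → Poly → Poly
normProd n h = prodP (map (λ j → substPow j h) (galoisExps n))

IsNormPP : ℕ → ℕ → Poly → ℤ → Set
IsNormPP p k h N =
  ∃ λ (q : Poly) → normProd (p ℕ.^ k) h ≈P ((N ∷ []) +P (cyclotomicPP p k *P q))

-- Σ_{t=0}^{p^k-1} ζ^{G(t)} as the polynomial Σ_t x^{G(t) mod p^k}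
-- (well defined since ζ^{p^k} = 1).
expSum : ℕ → ℕ → (ℤ → ℤ) → Poly
expSum p k G = sumP (map (λ t → xpow (modN (G (+ t)) (p ℕ.^ k))) (upTo (p ℕ.^ k)))

{-# OPTIONS --safe #-}
-- Let S(g) = Σ_{t < p^k} ζ^{g(t)}. The Galois conjugate of S(g) under ζ ↦ ζ^j is S(j g), so the norm
-- is the product of S(j g) over the units j mod p^k. Pairing j with p^k − j gives factors S(h) S(−h),
-- where h = j g is again of the form a + b t + c t² + p f(t) with p ∤ c, and each such factor is p^k;
-- there are φ(p^k)/2 pairs. The identity S(h) S(−h) = p^k holds in any commutative ring in which ζ is
-- a root of Φ_{p^k} (here ℤ[x]/(Φ_{p^k}) with ζ = x). For k ≤ 1 it is orthogonality of additive
-- characters. For k ≥ 2, sum over the cosets of p^{k−1}: they cancel except above the unique root r₀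
-- of h′ mod p, and substituting t = r₀ + p w gives S_k(ζ, h) = p ζ^{h(r₀)} S_{k−2}(ζ^{p²}, h₁) for a
-- phase h₁ of the same shape, which closes an induction on k.
module Submission where

open import Defs
open import Algebra.Bundles using (CommutativeMonoid; CommutativeRing)
open import Algebra.Structures using (IsCommutativeRing)
open import Data.Bool using (Bool; true; false; if_then_else_)
open import Data.Empty using (⊥-elim)
open import Data.Integer as ℤ using (ℤ; +_; _%ℕ_; _/ℕ_)
open import Data.Integer.DivMod using (a≡a%ℕn+[a/ℕn]*n; n%ℕd<d)
import Data.Integer.Divisibility.Signed as Signed
import Data.Integer.Properties as ℤP
open import Data.Integer.Tactic.RingSolver using (solve-∀)
open import Data.List using ([]; _∷_; map; foldr; filterᵇ; applyUpTo; upTo)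
open import Data.Maybe using (Maybe; just; nothing)
open import Data.Nat as ℕ using (ℕ; zero; suc; _<_; _≤_; _∸_; s≤s; z≤n; NonZero)
open import Data.Nat.Coprimality using (Coprime; coprime-Bézout; coprime⇒gcd≡1; coprime-divisor)
import Data.Nat.Divisibility as ℕD
open import Data.Nat.DivMod using (_%_; _/_; m≡m%n+[m/n]*n; m%n<n; m*n/n≡m; %-distribˡ-*)
open import Data.Nat.GCD using (gcd; gcd-greatest; module Bézout)
open import Data.Nat.Primality using (Prime; euclidsLemma; prime⇒irreducible; prime⇒nonZero; prime⇒nonTrivial)
import Data.Nat.Properties as ℕP
import Data.Nat.Tactic.RingSolver as ℕSolver
open import Data.Product using (_×_; _,_; ∃; ∃₂)
open import Data.Sum using (_⊎_; inj₁; inj₂; [_,_]′)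
open import Function using (_∘_; id)
open import Level using (0ℓ)
open import Relation.Binary.Bundles using (Setoid)
open import Relation.Binary.PropositionalEquality as ≡ using (_≡_; _≢_)
import Relation.Binary.Reasoning.Setoid
open import Relation.Nullary using (¬_; does; yes; no)
open import Relation.Nullary.Decidable using (dec-true; dec-false)
open import Tactic.RingSolver.Core.AlmostCommutativeRing using (fromCommutativeRing)
import Tactic.RingSolver.NonReflective as RingSolver

module RangeFold {c ℓ} (M : CommutativeMonoid c ℓ) where
  open CommutativeMonoid M
  open import Algebra.Properties.CommutativeSemigroup commutativeSemigroup using (interchange)
  open import Relation.Binary.Reasoning.Setoid setoid

  fold : ℕ → (ℕ → Carrier) → Carrier
  fold zero    f = ε
  fold (suc n) f = f 0 ∙ fold n (f ∘ suc)

  fold-cong< : ∀ n {f g : ℕ → Carrier} → (∀ i → i < n → f i ≈ g i) → fold n f ≈ fold n g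
  fold-cong< zero    f≈g = refl
  fold-cong< (suc n) f≈g = ∙-cong (f≈g 0 (s≤s z≤n)) (fold-cong< n (λ i i<n → f≈g (suc i) (s≤s i<n)))

  fold-cong : ∀ n {f g : ℕ → Carrier} → (∀ i → f i ≈ g i) → fold n f ≈ fold n g
  fold-cong n f≈g = fold-cong< n (λ i _ → f≈g i)

  fold-ε : ∀ n → fold n (λ _ → ε) ≈ ε
  fold-ε zero    = refl
  fold-ε (suc n) = trans (identityˡ _) (fold-ε n)

  fold-∙ : ∀ n (f g : ℕ → Carrier) → fold n (λ i → f i ∙ g i) ≈ fold n f ∙ fold n g
  fold-∙ zero    f g = sym (identityˡ ε)
  fold-∙ (suc n) f g = trans (∙-cong refl (fold-∙ n _ _)) (interchange _ _ _ _)

  fold-+ : ∀ m n (f : ℕ → Carrier) → fold (m ℕ.+ n) f ≈ fold m f ∙ fold n (λ i → f (m ℕ.+ i))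
  fold-+ zero    n f = sym (identityˡ _)
  fold-+ (suc m) n f = trans (∙-cong refl (fold-+ m n (f ∘ suc))) (sym (assoc _ _ _))

  fold-* : ∀ m n (f : ℕ → Carrier) → fold (m ℕ.* n) f ≈ fold m (λ v → fold n (λ u → f (v ℕ.* n ℕ.+ u)))
  fold-* zero    n f = refl
  fold-* (suc m) n f = trans (fold-+ n (m ℕ.* n) f) (∙-cong refl (trans (fold-* m n (λ t → f (n ℕ.+ t)))
    (fold-cong m (λ v → fold-cong n (λ u → reflexive (≡.cong f (≡.sym (ℕP.+-assoc n (v ℕ.* n) u))))))))

  fold-swap : ∀ m n (f : ℕ → ℕ → Carrier) → fold m (λ i → fold n (f i)) ≈ fold n (λ j → fold m (λ i → f i j))
  fold-swap zero    n f = sym (fold-ε n)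
  fold-swap (suc m) n f = trans (∙-cong refl (fold-swap m n (f ∘ suc))) (sym (fold-∙ n _ _))

  fold-last : ∀ n (f : ℕ → Carrier) → fold (suc n) f ≈ fold n f ∙ f n
  fold-last n f = begin
    fold (suc n) f                 ≡⟨ ≡.cong (λ m → fold m f) (ℕP.+-comm 1 n) ⟩
    fold (n ℕ.+ 1) f               ≈⟨ fold-+ n 1 f ⟩
    fold n f ∙ (f (n ℕ.+ 0) ∙ ε)   ≈⟨ ∙-cong refl (trans (identityʳ _) (reflexive (≡.cong f (ℕP.+-identityʳ n)))) ⟩
    fold n f ∙ f n                 ∎

  fold-reverse : ∀ n (f : ℕ → Carrier) → fold n f ≈ fold n (λ i → f (n ∸ suc i))
  fold-reverse zero    f = refl
  fold-reverse (suc n) f = begin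
    fold (suc n) f                       ≈⟨ fold-last n f ⟩
    fold n f ∙ f n                       ≈⟨ ∙-cong (fold-reverse n f) refl ⟩
    fold n (λ i → f (n ∸ suc i)) ∙ f n   ≈⟨ comm _ _ ⟩
    f n ∙ fold n (λ i → f (n ∸ suc i))   ∎

  fold-pairs : ∀ m (f : ℕ → Carrier) → fold (suc (m ℕ.+ m)) f ≈ f 0 ∙ fold m (λ i → f (suc i) ∙ f (m ℕ.+ m ∸ i))
  fold-pairs m f = ∙-cong refl (begin
    fold (m ℕ.+ m) (f ∘ suc)                                        ≈⟨ fold-+ m m _ ⟩
    fold m (f ∘ suc) ∙ fold m (λ u → f (suc (m ℕ.+ u)))             ≈⟨ ∙-cong refl (fold-reverse m _) ⟩
    fold m (f ∘ suc) ∙ fold m (λ i → f (suc (m ℕ.+ (m ∸ suc i))))   ≈⟨ ∙-cong refl (fold-cong< m (λ i i<m → reflexive (≡.cong f (mirror i<m)))) ⟩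
    fold m (f ∘ suc) ∙ fold m (λ i → f (m ℕ.+ m ∸ i))              ≈⟨ sym (fold-∙ m _ _) ⟩
    fold m (λ i → f (suc i) ∙ f (m ℕ.+ m ∸ i))                      ∎)
    where
    mirror : ∀ {i} → i < m → suc (m ℕ.+ (m ∸ suc i)) ≡ m ℕ.+ m ∸ i
    mirror {i} i<m = ≡.trans (≡.sym (ℕP.+-suc m (m ∸ suc i)))
      (≡.trans (≡.cong (m ℕ.+_) (≡.sym (ℕP.+-∸-assoc 1 i<m))) (≡.sym (ℕP.+-∸-assoc m (ℕP.<⇒≤ i<m))))

  fold-applyUpTo : ∀ (f : ℕ → Carrier) (g : ℕ → ℕ) n → foldr _∙_ ε (map f (applyUpTo g n)) ≈ fold n (f ∘ g)
  fold-applyUpTo f g zero    = refl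
  fold-applyUpTo f g (suc n) = ∙-cong refl (fold-applyUpTo f (g ∘ suc) n)

  fold-filter : ∀ (b : ℕ → Bool) (f : ℕ → Carrier) (g : ℕ → ℕ) n →
    foldr _∙_ ε (map f (filterᵇ b (applyUpTo g n))) ≈ fold n (λ i → if b (g i) then f (g i) else ε)
  fold-filter b f g zero = refl
  fold-filter b f g (suc n) with b (g 0)
  ... | true  = ∙-cong refl (fold-filter b f (g ∘ suc) n)
  ... | false = trans (fold-filter b f (g ∘ suc) n) (sym (identityˡ _))

pairs-mirror : ∀ {m i} → i < m → suc i ℕ.+ (m ℕ.+ m ∸ i) ≡ suc (m ℕ.+ m)
pairs-mirror {m} i<m = ≡.cong suc (ℕP.m+[n∸m]≡n (ℕP.≤-trans (ℕP.<⇒≤ i<m) (ℕP.m≤m+n m m)))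

count : ℕ → (ℕ → Bool) → ℕ
count n b = RangeFold.fold ℕP.+-0-commutativeMonoid n (λ i → if b i then 1 else 0)

module RingSums {c ℓ} (R : CommutativeRing c ℓ) where
  open CommutativeRing R
  open import Algebra.Properties.Semiring.Exp semiring public using (_^_; ^-congˡ; ^-homo-*; ^-assocʳ)
  import Algebra.Properties.Semiring.Mult semiring as Mult
  open import Algebra.Properties.Group +-group using (∙-cancelʳ)
  open import Relation.Binary.Reasoning.Setoid setoid

  open RangeFold +-commutativeMonoid public using () renaming
    (fold to Σ; fold-cong to Σ-cong; fold-cong< to Σ-cong<; fold-* to Σ-*;
     fold-swap to Σ-swap; fold-last to Σ-last; fold-applyUpTo to Σ-applyUpTo)
  open RangeFold *-commutativeMonoid public using () renaming
    (fold to Π; fold-cong< to Π-cong<; fold-pairs to Π-pairs; fold-filter to Π-filter)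

  Σ-distribˡ : ∀ n x (f : ℕ → Carrier) → x * Σ n f ≈ Σ n (λ i → x * f i)
  Σ-distribˡ zero    x f = zeroʳ x
  Σ-distribˡ (suc n) x f = trans (distribˡ _ _ _) (+-cong refl (Σ-distribˡ n x _))

  Σ-distribʳ : ∀ n x (f : ℕ → Carrier) → Σ n f * x ≈ Σ n (λ i → f i * x)
  Σ-distribʳ n x f = trans (*-comm _ _) (trans (Σ-distribˡ n x f) (Σ-cong n (λ i → *-comm _ _)))

  ι : ℕ → Carrier
  ι n = n Mult.× 1#

  ι-* : ∀ m n → ι (m ℕ.* n) ≈ ι m * ι n
  ι-* = Mult.×1-homo-*

  ι-^ : ∀ m n → ι (m ℕ.^ n) ≈ ι m ^ n
  ι-^ m zero    = +-identityʳ 1#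
  ι-^ m (suc n) = trans (ι-* m (m ℕ.^ n)) (*-cong refl (ι-^ m n))

  Σ-1 : ∀ n → Σ n (λ _ → 1#) ≈ ι n
  Σ-1 zero    = refl
  Σ-1 (suc n) = +-cong refl (Σ-1 n)

  Σ-zero : ∀ n (f : ℕ → Carrier) → (∀ i → i < n → f i ≈ 0#) → Σ n f ≈ 0#
  Σ-zero zero    f f≈0 = refl
  Σ-zero (suc n) f f≈0 = trans (+-cong (f≈0 0 (s≤s z≤n)) (Σ-zero n _ (λ i i<n → f≈0 (suc i) (s≤s i<n)))) (+-identityˡ 0#)

  Σ-single : ∀ n (f : ℕ → Carrier) r → r < n → (∀ i → i < n → i ≢ r → f i ≈ 0#) → Σ n f ≈ f r
  Σ-single (suc n) f zero    _         f≈0 = trans (+-cong refl (Σ-zero n _ (λ i i<n → f≈0 (suc i) (s≤s i<n) (λ ())))) (+-identityʳ _)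
  Σ-single (suc n) f (suc r) (s≤s r<n) f≈0 = trans (+-cong (f≈0 0 (s≤s z≤n) (λ ()))
    (Σ-single n (f ∘ suc) r r<n (λ i i<n i≢r → f≈0 (suc i) (s≤s i<n) (i≢r ∘ ℕP.suc-injective)))) (+-identityˡ _)

  Σ-periodic : ∀ n (f : ℕ → Carrier) → (∀ s → f (s ℕ.+ n) ≈ f s) → ∀ t → Σ n (λ d → f (t ℕ.+ d)) ≈ Σ n f
  Σ-periodic n f f-per zero    = refl
  Σ-periodic n f f-per (suc t) = trans (∙-cancelʳ (g 0) _ _ (begin
      Σ n (λ d → f (suc t ℕ.+ d)) + g 0   ≈⟨ +-comm _ _ ⟩
      g 0 + Σ n (λ d → f (suc t ℕ.+ d))   ≈⟨ +-cong refl (Σ-cong n (λ d → reflexive (≡.cong f (≡.sym (ℕP.+-suc t d))))) ⟩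
      Σ (suc n) g                         ≈⟨ Σ-last n g ⟩
      Σ n g + f (t ℕ.+ n)                 ≈⟨ +-cong refl (trans (f-per t) (reflexive (≡.cong f (≡.sym (ℕP.+-identityʳ t))))) ⟩
      Σ n g + g 0                         ∎)) (Σ-periodic n f f-per t)
    where
    g : ℕ → Carrier
    g d = f (t ℕ.+ d)

  Σ-permute : ∀ n (f : ℕ → Carrier) (σ τ : ℕ → ℕ) →
    (∀ v → v < n → σ v < n) → (∀ u → u < n → τ u < n) →
    (∀ u → u < n → σ (τ u) ≡ u) → (∀ v → v < n → τ (σ v) ≡ v) →
    Σ n (f ∘ σ) ≈ Σ n f
  Σ-permute n f σ τ σ< τ< στ≗id τσ≗id = begin
    Σ n (f ∘ σ)                                ≈⟨ Σ-cong< n (λ v v<n → sym (spread v<n)) ⟩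
    Σ n (λ v → Σ n (λ u → δ u (σ v) * f u))   ≈⟨ Σ-swap n n _ ⟩
    Σ n (λ u → Σ n (λ v → δ u (σ v) * f u))   ≈⟨ Σ-cong< n (λ u u<n → gather u<n) ⟩
    Σ n f                                      ∎
    where
    δ : ℕ → ℕ → Carrier
    δ u w = if does (u ℕ.≟ w) then 1# else 0#
    δ-*-≡ : ∀ {u w x} → u ≡ w → δ u w * x ≈ x
    δ-*-≡ {u} {w} u≡w = trans (*-cong (reflexive (≡.cong (if_then 1# else 0#) (dec-true (u ℕ.≟ w) u≡w))) refl) (*-identityˡ _)
    δ-*-≢ : ∀ {u w x} → u ≢ w → δ u w * x ≈ 0#
    δ-*-≢ {u} {w} u≢w = trans (*-cong (reflexive (≡.cong (if_then 1# else 0#) (dec-false (u ℕ.≟ w) u≢w))) refl) (zeroˡ _)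
    τ-inverts : ∀ {u v} → v < n → u ≡ σ v → v ≡ τ u
    τ-inverts v<n ≡.refl = ≡.sym (τσ≗id _ v<n)
    spread : ∀ {v} → v < n → Σ n (λ u → δ u (σ v) * f u) ≈ f (σ v)
    spread {v} v<n = trans (Σ-single n _ (σ v) (σ< v v<n) (λ _ _ → δ-*-≢)) (δ-*-≡ {σ v} ≡.refl)
    gather : ∀ {u} → u < n → Σ n (λ v → δ u (σ v) * f u) ≈ f u
    gather {u} u<n = trans (Σ-single n _ (τ u) (τ< u u<n) (λ v v<n v≢τu → δ-*-≢ (v≢τu ∘ τ-inverts v<n)))
                           (δ-*-≡ (≡.sym (στ≗id u u<n)))

  Σ^≈0⇒^≈1 : ∀ n x → Σ n (x ^_) ≈ 0# → x ^ n ≈ 1#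
  Σ^≈0⇒^≈1 n x S≈0 = begin
    x ^ n                  ≈⟨ +-identityˡ _ ⟨
    0# + x ^ n             ≈⟨ +-cong S≈0 refl ⟨
    Σ n (x ^_) + x ^ n     ≈⟨ Σ-last n (x ^_) ⟨
    Σ (suc n) (x ^_)       ≈⟨ +-cong refl (Σ-distribˡ n x (x ^_)) ⟨
    1# + x * Σ n (x ^_)    ≈⟨ +-cong refl (trans (*-cong refl S≈0) (zeroʳ x)) ⟩
    1# + 0#                ≈⟨ +-identityʳ 1# ⟩
    1#                     ∎

  1#^≈1# : ∀ n → 1# ^ n ≈ 1#
  1#^≈1# zero    = refl
  1#^≈1# (suc n) = trans (*-identityˡ _) (1#^≈1# n)

  Π-if : ∀ n (b : ℕ → Bool) x → Π n (λ i → if b i then x else 1#) ≈ x ^ count n b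
  Π-if zero    b x = refl
  Π-if (suc n) b x = trans (*-cong (first (b 0)) (Π-if n (b ∘ suc) x)) (sym (^-homo-* x (if b 0 then 1 else 0) (count n (b ∘ suc))))
    where
    first : ∀ β → (if β then x else 1#) ≈ x ^ (if β then 1 else 0)
    first true  = sym (*-identityʳ x)
    first false = refl

-- Signed divisibility is opened locally: the statement of proposition5p9 uses the unsigned _∣_.
module _ where
  open import Data.Integer.Divisibility.Signed

  -- A record, so that a and b can be inferred from a proof of a ≡ b mod n.
  infix 4 _≡_mod_
  record _≡_mod_ (a b : ℤ) (n : ℕ) : Set where
    constructor mod-intro
    field ∣-diff : + n ∣ a ℤ.- b
  open _≡_mod_ public

  module _ {n : ℕ} where

    mod-reflexive : ∀ {a b} → a ≡ b → a ≡ b mod n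
    mod-reflexive {a} ≡.refl = mod-intro (divides (+ 0) (ℤP.+-inverseʳ a))

    mod-refl : ∀ {a} → a ≡ a mod n
    mod-refl = mod-reflexive ≡.refl

    mod-sym : ∀ {a b} → a ≡ b mod n → b ≡ a mod n
    mod-sym {a} {b} (mod-intro a≡b) = mod-intro (≡.subst (+ n ∣_) (negate a b) (∣m⇒∣-m a≡b))
      where
      negate : ∀ a b → ℤ.- (a ℤ.- b) ≡ b ℤ.- a
      negate = solve-∀

    mod-trans : ∀ {a b c} → a ≡ b mod n → b ≡ c mod n → a ≡ c mod n
    mod-trans {a} {b} {c} (mod-intro a≡b) (mod-intro b≡c) = mod-intro (≡.subst (+ n ∣_) (ℤP.+-minus-telescope a b c) (∣m∣n⇒∣m+n a≡b b≡c))

    mod-+ : ∀ {a b c d} → a ≡ b mod n → c ≡ d mod n → a ℤ.+ c ≡ b ℤ.+ d mod n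
    mod-+ {a} {b} {c} {d} (mod-intro a≡b) (mod-intro c≡d) = mod-intro (≡.subst (+ n ∣_) (regroup a b c d) (∣m∣n⇒∣m+n a≡b c≡d))
      where
      regroup : ∀ a b c d → (a ℤ.- b) ℤ.+ (c ℤ.- d) ≡ (a ℤ.+ c) ℤ.- (b ℤ.+ d)
      regroup = solve-∀

    mod-* : ∀ {a b c d} → a ≡ b mod n → c ≡ d mod n → a ℤ.* c ≡ b ℤ.* d mod n
    mod-* {a} {b} {c} {d} (mod-intro a≡b) (mod-intro c≡d) =
      mod-intro (≡.subst (+ n ∣_) (regroup a b c d) (∣m∣n⇒∣m+n (∣n⇒∣m*n a c≡d) (∣n⇒∣m*n d a≡b)))
      where
      regroup : ∀ a b c d → a ℤ.* (c ℤ.- d) ℤ.+ d ℤ.* (a ℤ.- b) ≡ a ℤ.* c ℤ.- b ℤ.* d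
      regroup = solve-∀

    mod-*ˡ : ∀ k {a b} → a ≡ b mod n → k ℤ.* a ≡ k ℤ.* b mod n
    mod-*ˡ k = mod-* (mod-refl {k})

    mod-multiple : ∀ a {x} → + n ∣ x → a ℤ.+ x ≡ a mod n
    mod-multiple a {x} n∣x = mod-intro (≡.subst (+ n ∣_) (cancel a x) n∣x)
      where
      cancel : ∀ a x → x ≡ a ℤ.+ x ℤ.- a
      cancel = solve-∀

  mod-∣ : ∀ {n a b} → a ≡ b mod n → + n ∣ b → + n ∣ a
  mod-∣ {n} {a} {b} (mod-intro n∣a-b) n∣b = ≡.subst (+ n ∣_) (cancel a b) (∣m∣n⇒∣m+n n∣a-b n∣b)
    where
    cancel : ∀ a b → a ℤ.- b ℤ.+ b ≡ a
    cancel = solve-∀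

  mod-scale : ∀ m {n a b} → a ≡ b mod n → + m ℤ.* a ≡ + m ℤ.* b mod (m ℕ.* n)
  mod-scale m {n} {a} {b} (mod-intro (divides q a-b≡qn)) = mod-intro (divides q (begin
    + m ℤ.* a ℤ.- + m ℤ.* b   ≡⟨ factor (+ m) a b ⟩
    + m ℤ.* (a ℤ.- b)         ≡⟨ ≡.cong (+ m ℤ.*_) a-b≡qn ⟩
    + m ℤ.* (q ℤ.* + n)       ≡⟨ reassociate (+ m) q (+ n) ⟩
    q ℤ.* (+ m ℤ.* + n)       ≡⟨ ≡.cong (q ℤ.*_) (ℤP.pos-* m n) ⟨
    q ℤ.* + (m ℕ.* n)         ∎))
    where
    open ≡.≡-Reasoning
    factor : ∀ m a b → m ℤ.* a ℤ.- m ℤ.* b ≡ m ℤ.* (a ℤ.- b)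
    factor = solve-∀
    reassociate : ∀ m q n → m ℤ.* (q ℤ.* n) ≡ q ℤ.* (m ℤ.* n)
    reassociate = solve-∀

  mod-weaken : ∀ {m n a b} → m ℕD.∣ n → a ≡ b mod n → a ≡ b mod m
  mod-weaken m∣n (mod-intro n∣a-b) = mod-intro (∣-trans (∣ᵤ⇒∣ m∣n) n∣a-b)

  mod-setoid : ℕ → Setoid 0ℓ 0ℓ
  mod-setoid n = record
    { Carrier = ℤ
    ; _≈_ = λ a b → a ≡ b mod n
    ; isEquivalence = record { refl = mod-refl ; sym = mod-sym ; trans = mod-trans } }

  module ModReasoning (n : ℕ) = Relation.Binary.Reasoning.Setoid (mod-setoid n)

  pos-affine : ∀ u m v → + (v ℕ.* m ℕ.+ u) ≡ + u ℤ.+ + m ℤ.* + v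
  pos-affine u m v = begin
    + (v ℕ.* m ℕ.+ u)        ≡⟨ ℤP.pos-+ (v ℕ.* m) u ⟩
    + (v ℕ.* m) ℤ.+ + u      ≡⟨ ≡.cong (ℤ._+ + u) (ℤP.pos-* v m) ⟩
    + v ℤ.* + m ℤ.+ + u      ≡⟨ swap (+ v) (+ m) (+ u) ⟩
    + u ℤ.+ + m ℤ.* + v      ∎
    where
    open ≡.≡-Reasoning
    swap : ∀ v m u → v ℤ.* m ℤ.+ u ≡ u ℤ.+ m ℤ.* v
    swap = solve-∀

  modN-correct : ∀ n .{{_ : NonZero n}} z → z ≡ + modN z n mod n
  modN-correct (suc m) z = mod-intro (divides (z /ℕ suc m) (≡.trans (≡.cong (ℤ._- r) (a≡a%ℕn+[a/ℕn]*n z (suc m))) (cancel r (z /ℕ suc m) (+ suc m))))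
    where
    r : ℤ
    r = + (z %ℕ suc m)
    cancel : ∀ r q n → r ℤ.+ q ℤ.* n ℤ.- r ≡ q ℤ.* n
    cancel = solve-∀

  modN-< : ∀ n .{{_ : NonZero n}} z → modN z n < n
  modN-< (suc m) z = n%ℕd<d z (suc m)

  modN-pos : ∀ n .{{_ : NonZero n}} i → modN (+ i) n ≡ i ℕ.% n
  modN-pos (suc m) i = ≡.refl

  private
    residue-unique-≤ : ∀ {n r s} → s ≤ r → r < n → + r ≡ + s mod n → r ≡ s
    residue-unique-≤ {n} {r} {s} s≤r r<n (mod-intro n∣r-s) with r ℕ.∸ s in r∸s≡
    ... | zero  = ℕP.≤-antisym (ℕP.m∸n≡0⇒m≤n r∸s≡) s≤r
    ... | suc d = ⊥-elim (ℕD.>⇒∤ r∸s<n n∣r∸s)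
      where
      r∸s<n : suc d < n
      r∸s<n = ℕP.≤-<-trans (ℕP.≤-trans (ℕP.≤-reflexive (≡.sym r∸s≡)) (ℕP.m∸n≤m r s)) r<n
      n∣r∸s : n ℕD.∣ suc d
      n∣r∸s = ≡.subst (n ℕD.∣_) (≡.cong ℤ.∣_∣ (≡.trans (ℤP.m-n≡m⊖n r s) (≡.trans (ℤP.⊖-≥ s≤r) (≡.cong +_ r∸s≡))))
                (∣⇒∣ᵤ n∣r-s)

  residue-unique : ∀ {n r s} → r < n → s < n → + r ≡ + s mod n → r ≡ s
  residue-unique {n} {r} {s} r<n s<n r≡s with ℕP.≤-total s r
  ... | inj₁ s≤r = residue-unique-≤ s≤r r<n r≡s
  ... | inj₂ r≤s = ≡.sym (residue-unique-≤ r≤s s<n (mod-sym r≡s))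

  modN-cong : ∀ {n} .{{_ : NonZero n}} {a b} → a ≡ b mod n → modN a n ≡ modN b n
  modN-cong {n} {a} {b} a≡b = residue-unique (modN-< n a) (modN-< n b)
    (mod-trans (mod-sym (modN-correct n a)) (mod-trans a≡b (modN-correct n b)))

  modN-*-inverse : ∀ {n} .{{_ : NonZero n}} {e e′ v} → e ℤ.* e′ ≡ + 1 mod n → v < n →
    modN (+ modN (+ v ℤ.* e) n ℤ.* e′) n ≡ v
  modN-*-inverse {n} {e} {e′} {v} ee′≡1 v<n = residue-unique (modN-< n _) v<n (begin
    + modN (+ modN (+ v ℤ.* e) n ℤ.* e′) n   ≈⟨ modN-correct n _ ⟨
    + modN (+ v ℤ.* e) n ℤ.* e′              ≈⟨ mod-* (modN-correct n (+ v ℤ.* e)) (mod-refl {a = e′}) ⟨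
    + v ℤ.* e ℤ.* e′                         ≡⟨ ℤP.*-assoc (+ v) e e′ ⟩
    + v ℤ.* (e ℤ.* e′)                       ≈⟨ mod-*ˡ (+ v) ee′≡1 ⟩
    + v ℤ.* + 1                              ≡⟨ ℤP.*-identityʳ (+ v) ⟩
    + v                                      ∎)
    where open ModReasoning n

  module _ {p : ℕ} (p-prime : Prime p) where

    prime∤⇒coprime : ∀ {m} → ¬ p ℕD.∣ m → Coprime p m
    prime∤⇒coprime p∤m (d∣p , d∣m) with prime⇒irreducible p-prime d∣p
    ... | inj₁ d≡1 = d≡1
    ... | inj₂ ≡.refl = ⊥-elim (p∤m d∣m)

    prime∣*⇒∣⊎∣ : ∀ a b → + p ∣ a ℤ.* b → + p ∣ a ⊎ + p ∣ b
    prime∣*⇒∣⊎∣ a b p∣ab with euclidsLemma ℤ.∣ a ∣ ℤ.∣ b ∣ p-prime (≡.subst (p ℕD.∣_) (ℤP.abs-* a b) (∣⇒∣ᵤ p∣ab))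
    ... | inj₁ p∣a = inj₁ (∣ᵤ⇒∣ p∣a)
    ... | inj₂ p∣b = inj₂ (∣ᵤ⇒∣ p∣b)

    private
      inverse-ℕ : ∀ {m} → ¬ p ℕD.∣ m → ∃ λ u → u ℤ.* + m ≡ + 1 mod p
      inverse-ℕ {m} p∤m with coprime-Bézout (prime∤⇒coprime p∤m)
      ... | Bézout.+- x y eq = ℤ.- + y , mod-intro (divides (ℤ.- + x) (begin
        ℤ.- + y ℤ.* + m ℤ.- + 1   ≡⟨ negate-sum (+ y) (+ m) ⟩
        ℤ.- (+ 1 ℤ.+ + y ℤ.* + m) ≡⟨ ≡.cong ℤ.-_ (≡.trans (ℤP.pos-+ 1 (y ℕ.* m)) (≡.cong (ℤ._+_ (+ 1)) (ℤP.pos-* y m))) ⟨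
        ℤ.- + (1 ℕ.+ y ℕ.* m)     ≡⟨ ≡.cong (λ z → ℤ.- + z) eq ⟩
        ℤ.- + (x ℕ.* p)           ≡⟨ ≡.trans (≡.cong ℤ.-_ (ℤP.pos-* x p)) (ℤP.neg-distribˡ-* (+ x) (+ p)) ⟩
        ℤ.- + x ℤ.* + p           ∎))
        where
        open ≡.≡-Reasoning
        negate-sum : ∀ y m → ℤ.- y ℤ.* m ℤ.- + 1 ≡ ℤ.- (+ 1 ℤ.+ y ℤ.* m)
        negate-sum = solve-∀
      ... | Bézout.-+ x y eq = + y , mod-intro (divides (+ x) (begin
        + y ℤ.* + m ℤ.- + 1         ≡⟨ ≡.cong (ℤ._- + 1) (ℤP.pos-* y m) ⟨
        + (y ℕ.* m) ℤ.- + 1         ≡⟨ ≡.cong (λ z → + z ℤ.- + 1) eq ⟨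
        + (1 ℕ.+ x ℕ.* p) ℤ.- + 1   ≡⟨ ≡.cong (ℤ._- + 1) (ℤP.pos-+ 1 (x ℕ.* p)) ⟩
        + 1 ℤ.+ + (x ℕ.* p) ℤ.- + 1 ≡⟨ cancel (+ (x ℕ.* p)) ⟩
        + (x ℕ.* p)                 ≡⟨ ℤP.pos-* x p ⟩
        + x ℤ.* + p                 ∎))
        where
        open ≡.≡-Reasoning
        cancel : ∀ z → + 1 ℤ.+ z ℤ.- + 1 ≡ z
        cancel = solve-∀

    inverse : ∀ e → ¬ + p ∣ e → ∃ λ u → u ℤ.* e ≡ + 1 mod p
    inverse e p∤e with ℤP.+∣i∣≡i⊎+∣i∣≡-i e | inverse-ℕ (p∤e ∘ ∣ᵤ⇒∣)
    ... | inj₁ |e|≡e  | u , u|e|≡1 = u , ≡.subst (λ z → u ℤ.* z ≡ + 1 mod p) |e|≡e u|e|≡1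
    ... | inj₂ |e|≡-e | u , u|e|≡1 = ℤ.- u , ≡.subst (_≡ + 1 mod p) (move-sign u e) (≡.subst (λ z → u ℤ.* z ≡ + 1 mod p) |e|≡-e u|e|≡1)
      where
      move-sign : ∀ u e → u ℤ.* ℤ.- e ≡ ℤ.- u ℤ.* e
      move-sign = solve-∀

    linear-root : ∀ e → ¬ + p ∣ e → ∀ b → ∃ λ r → r < p × + p ∣ b ℤ.+ e ℤ.* + r
    linear-root e p∤e b with inverse e p∤e
    ... | u , ue≡1 = r , modN-< p (ℤ.- b ℤ.* u) , ≡.subst (+ p ∣_) (ℤP.+-identityʳ _) (∣-diff (begin
        b ℤ.+ e ℤ.* + r                   ≈⟨ mod-+ (mod-refl {a = b}) (mod-*ˡ e (mod-sym (modN-correct p (ℤ.- b ℤ.* u)))) ⟩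
        b ℤ.+ e ℤ.* (ℤ.- b ℤ.* u)         ≡⟨ rearrange b e u ⟩
        b ℤ.+ ℤ.- b ℤ.* (u ℤ.* e)         ≈⟨ mod-+ (mod-refl {a = b}) (mod-*ˡ (ℤ.- b) ue≡1) ⟩
        b ℤ.+ ℤ.- b ℤ.* + 1               ≡⟨ cancel b ⟩
        + 0                               ∎))
      where
      instance _ = prime⇒nonZero p-prime
      r : ℕ
      r = modN (ℤ.- b ℤ.* u) p
      rearrange : ∀ b e u → b ℤ.+ e ℤ.* (ℤ.- b ℤ.* u) ≡ b ℤ.+ ℤ.- b ℤ.* (u ℤ.* e)
      rearrange = solve-∀
      cancel : ∀ b → b ℤ.+ ℤ.- b ℤ.* + 1 ≡ + 0
      cancel = solve-∀
      open ModReasoning p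

    linear-root-unique : ∀ e → ¬ + p ∣ e → ∀ b {r s} → r < p → s < p →
      + p ∣ b ℤ.+ e ℤ.* + r → + p ∣ b ℤ.+ e ℤ.* + s → r ≡ s
    linear-root-unique e p∤e b {r} {s} r<p s<p p∣b+er p∣b+es
      with prime∣*⇒∣⊎∣ e (+ r ℤ.- + s) (≡.subst (+ p ∣_) (difference b e (+ r) (+ s)) (∣m∣n⇒∣m-n p∣b+er p∣b+es))
      where
      difference : ∀ b e r s → (b ℤ.+ e ℤ.* r) ℤ.- (b ℤ.+ e ℤ.* s) ≡ e ℤ.* (r ℤ.- s)
      difference = solve-∀
    ... | inj₁ p∣e   = ⊥-elim (p∤e p∣e)
    ... | inj₂ p∣r-s = residue-unique r<p s<p (mod-intro p∣r-s)

module _ where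
  open import Data.Integer.Divisibility.Signed using (_∣_; divides; ∣m⇒∣-m; ∣-refl; ∣m∣n⇒∣m+n; ∣m⇒∣m*n; ∣n⇒∣m*n; ∣ᵤ⇒∣)

  evalZ-+P : ∀ P Q t → evalZ (P +P Q) t ≡ evalZ P t ℤ.+ evalZ Q t
  evalZ-+P []      Q       t = ≡.sym (ℤP.+-identityˡ _)
  evalZ-+P (a ∷ P) []      t = ≡.sym (ℤP.+-identityʳ _)
  evalZ-+P (a ∷ P) (b ∷ Q) t = ≡.trans (≡.cong (λ z → a ℤ.+ b ℤ.+ t ℤ.* z) (evalZ-+P P Q t)) (distribute a b t (evalZ P t) (evalZ Q t))
    where
    distribute : ∀ a b t x y → a ℤ.+ b ℤ.+ t ℤ.* (x ℤ.+ y) ≡ a ℤ.+ t ℤ.* x ℤ.+ (b ℤ.+ t ℤ.* y)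
    distribute = solve-∀

  evalZ-·P : ∀ c P t → evalZ (c ·P P) t ≡ c ℤ.* evalZ P t
  evalZ-·P c []      t = ≡.sym (ℤP.*-zeroʳ c)
  evalZ-·P c (a ∷ P) t = ≡.trans (≡.cong (λ z → c ℤ.* a ℤ.+ t ℤ.* z) (evalZ-·P c P t)) (distribute c a t (evalZ P t))
    where
    distribute : ∀ c a t x → c ℤ.* a ℤ.+ t ℤ.* (c ℤ.* x) ≡ c ℤ.* (a ℤ.+ t ℤ.* x)
    distribute = solve-∀

  evalZ-cong : ∀ h {n s t} → s ≡ t mod n → evalZ h s ≡ evalZ h t mod n
  evalZ-cong []      s≡t = mod-refl
  evalZ-cong (a ∷ h) s≡t = mod-+ (mod-refl {a = a}) (mod-* s≡t (evalZ-cong h s≡t))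

  evalZ-taylor : ∀ h r P → ∃₂ λ h′ H → ∀ w → evalZ h (r ℤ.+ P ℤ.* w) ≡ evalZ h r ℤ.+ h′ ℤ.* P ℤ.* w ℤ.+ P ℤ.* P ℤ.* evalZ H w
  evalZ-taylor []      r P = + 0 , [] , λ w → vanish P w
    where
    vanish : ∀ P w → + 0 ≡ + 0 ℤ.+ + 0 ℤ.* P ℤ.* w ℤ.+ P ℤ.* P ℤ.* + 0
    vanish = solve-∀
  evalZ-taylor (a ∷ h) r P with evalZ-taylor h r P
  ... | h′ , H , expand = A ℤ.+ r ℤ.* h′ , H₁ , λ w → begin
      a ℤ.+ (r ℤ.+ P ℤ.* w) ℤ.* evalZ h (r ℤ.+ P ℤ.* w)
        ≡⟨ ≡.cong (λ z → a ℤ.+ (r ℤ.+ P ℤ.* w) ℤ.* z) (expand w) ⟩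
      a ℤ.+ (r ℤ.+ P ℤ.* w) ℤ.* (A ℤ.+ h′ ℤ.* P ℤ.* w ℤ.+ P ℤ.* P ℤ.* evalZ H w)
        ≡⟨ multiply-out a r P w A h′ (evalZ H w) ⟩
      a ℤ.+ r ℤ.* A ℤ.+ (A ℤ.+ r ℤ.* h′) ℤ.* P ℤ.* w ℤ.+ P ℤ.* P ℤ.* (r ℤ.* evalZ H w ℤ.+ w ℤ.* (w ℤ.* h′ ℤ.+ P ℤ.* evalZ H w))
        ≡⟨ ≡.cong (λ z → a ℤ.+ r ℤ.* A ℤ.+ (A ℤ.+ r ℤ.* h′) ℤ.* P ℤ.* w ℤ.+ P ℤ.* P ℤ.* z) (evalZ-H₁ w) ⟨
      a ℤ.+ r ℤ.* A ℤ.+ (A ℤ.+ r ℤ.* h′) ℤ.* P ℤ.* w ℤ.+ P ℤ.* P ℤ.* evalZ H₁ w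
        ∎
    where
    open ≡.≡-Reasoning
    A : ℤ
    A = evalZ h r
    H₁ : Poly
    H₁ = r ·P H +P (+ 0 ∷ ((+ 0 ∷ h′ ∷ []) +P P ·P H))
    evalZ-H₁ : ∀ w → evalZ H₁ w ≡ r ℤ.* evalZ H w ℤ.+ w ℤ.* (w ℤ.* h′ ℤ.+ P ℤ.* evalZ H w)
    evalZ-H₁ w = ≡.trans (evalZ-+P (r ·P H) _ w) (≡.trans (≡.cong₂ ℤ._+_ (evalZ-·P r H w)
      (≡.cong (λ z → + 0 ℤ.+ w ℤ.* z) (≡.trans (evalZ-+P (+ 0 ∷ h′ ∷ []) (P ·P H) w)
                                               (≡.cong (ℤ._+_ (evalZ (+ 0 ∷ h′ ∷ []) w)) (evalZ-·P P H w)))))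
      (tidy r (evalZ H w) w h′ P))
      where
      tidy : ∀ r x w h′ P → r ℤ.* x ℤ.+ (+ 0 ℤ.+ w ℤ.* (+ 0 ℤ.+ w ℤ.* (h′ ℤ.+ w ℤ.* + 0) ℤ.+ P ℤ.* x))
                          ≡ r ℤ.* x ℤ.+ w ℤ.* (w ℤ.* h′ ℤ.+ P ℤ.* x)
      tidy = solve-∀
    multiply-out : ∀ a r P w A h′ x →
      a ℤ.+ (r ℤ.+ P ℤ.* w) ℤ.* (A ℤ.+ h′ ℤ.* P ℤ.* w ℤ.+ P ℤ.* P ℤ.* x)
        ≡ a ℤ.+ r ℤ.* A ℤ.+ (A ℤ.+ r ℤ.* h′) ℤ.* P ℤ.* w ℤ.+ P ℤ.* P ℤ.* (r ℤ.* x ℤ.+ w ℤ.* (w ℤ.* h′ ℤ.+ P ℤ.* x))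
    multiply-out = solve-∀

  record QuadraticPhase (p : ℕ) (g : ℤ → ℤ) : Set where
    field
      a b c : ℤ
      h     : Poly
      p∤c   : ¬ + p ∣ c
      g≗    : ∀ t → g t ≡ a ℤ.+ b ℤ.* t ℤ.+ c ℤ.* t ℤ.* t ℤ.+ + p ℤ.* evalZ h t

    slope : ℤ → ℤ
    slope t = b ℤ.+ + 2 ℤ.* c ℤ.* t

  module _ {p : ℕ} {g : ℤ → ℤ} (G : QuadraticPhase p g) where
    open QuadraticPhase G

    phase-expand : ∀ m T D → + m ∣ D → g (T ℤ.+ D) ≡ g T ℤ.+ (D ℤ.* slope T ℤ.+ c ℤ.* D ℤ.* D) mod (p ℕ.* m)
    phase-expand m T D m∣D = begin
      g (T ℤ.+ D)
        ≡⟨ g≗ (T ℤ.+ D) ⟩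
      a ℤ.+ b ℤ.* (T ℤ.+ D) ℤ.+ c ℤ.* (T ℤ.+ D) ℤ.* (T ℤ.+ D) ℤ.+ + p ℤ.* evalZ h (T ℤ.+ D)
        ≈⟨ mod-+ (mod-refl {a = a ℤ.+ b ℤ.* (T ℤ.+ D) ℤ.+ c ℤ.* (T ℤ.+ D) ℤ.* (T ℤ.+ D)}) (mod-scale p (evalZ-cong h (mod-multiple T m∣D))) ⟩
      a ℤ.+ b ℤ.* (T ℤ.+ D) ℤ.+ c ℤ.* (T ℤ.+ D) ℤ.* (T ℤ.+ D) ℤ.+ + p ℤ.* evalZ h T
        ≡⟨ expand-square a b c T D (+ p ℤ.* evalZ h T) ⟩
      (a ℤ.+ b ℤ.* T ℤ.+ c ℤ.* T ℤ.* T ℤ.+ + p ℤ.* evalZ h T) ℤ.+ (D ℤ.* slope T ℤ.+ c ℤ.* D ℤ.* D)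
        ≡⟨ ≡.cong (ℤ._+ (D ℤ.* slope T ℤ.+ c ℤ.* D ℤ.* D)) (g≗ T) ⟨
      g T ℤ.+ (D ℤ.* slope T ℤ.+ c ℤ.* D ℤ.* D)
        ∎
      where
      open ModReasoning (p ℕ.* m)
      expand-square : ∀ a b c T D x → a ℤ.+ b ℤ.* (T ℤ.+ D) ℤ.+ c ℤ.* (T ℤ.+ D) ℤ.* (T ℤ.+ D) ℤ.+ x
                                    ≡ (a ℤ.+ b ℤ.* T ℤ.+ c ℤ.* T ℤ.* T ℤ.+ x) ℤ.+ (D ℤ.* (b ℤ.+ + 2 ℤ.* c ℤ.* T) ℤ.+ c ℤ.* D ℤ.* D)
      expand-square = solve-∀

    phase-neg : QuadraticPhase p (λ t → ℤ.- g t)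
    phase-neg = record
      { a = ℤ.- a ; b = ℤ.- b ; c = ℤ.- c ; h = ℤ.- + 1 ·P h
      ; p∤c = λ p∣-c → p∤c (≡.subst (+ p ∣_) (ℤP.neg-involutive c) (∣m⇒∣-m p∣-c))
      ; g≗ = λ t → ≡.trans (≡.cong ℤ.-_ (g≗ t)) (≡.trans (negate a b c t (+ p) (evalZ h t))
          (≡.cong (λ z → ℤ.- a ℤ.+ ℤ.- b ℤ.* t ℤ.+ ℤ.- c ℤ.* t ℤ.* t ℤ.+ + p ℤ.* z) (≡.sym (evalZ-·P (ℤ.- + 1) h t)))) }
      where
      negate : ∀ a b c t p x → ℤ.- (a ℤ.+ b ℤ.* t ℤ.+ c ℤ.* t ℤ.* t ℤ.+ p ℤ.* x)
                              ≡ ℤ.- a ℤ.+ ℤ.- b ℤ.* t ℤ.+ ℤ.- c ℤ.* t ℤ.* t ℤ.+ p ℤ.* (ℤ.- + 1 ℤ.* x)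
      negate = solve-∀

    phase-* : Prime p → ∀ k → ¬ + p ∣ k → QuadraticPhase p (λ t → k ℤ.* g t)
    phase-* p-prime k p∤k = record
      { a = k ℤ.* a ; b = k ℤ.* b ; c = k ℤ.* c ; h = k ·P h
      ; p∤c = λ p∣kc → [ p∤k , p∤c ]′ (prime∣*⇒∣⊎∣ p-prime k c p∣kc)
      ; g≗ = λ t → ≡.trans (≡.cong (k ℤ.*_) (g≗ t)) (≡.trans (scale k a b c t (+ p) (evalZ h t))
          (≡.cong (λ z → k ℤ.* a ℤ.+ k ℤ.* b ℤ.* t ℤ.+ k ℤ.* c ℤ.* t ℤ.* t ℤ.+ + p ℤ.* z) (≡.sym (evalZ-·P k h t)))) }
      where
      scale : ∀ k a b c t p x → k ℤ.* (a ℤ.+ b ℤ.* t ℤ.+ c ℤ.* t ℤ.* t ℤ.+ p ℤ.* x)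
                               ≡ k ℤ.* a ℤ.+ k ℤ.* b ℤ.* t ℤ.+ k ℤ.* c ℤ.* t ℤ.* t ℤ.+ p ℤ.* (k ℤ.* x)
      scale = solve-∀

    critical-expansion : ∀ r → + p ∣ slope r →
      ∃ λ g′ → QuadraticPhase p g′ × (∀ w → g (r ℤ.+ + p ℤ.* w) ≡ g r ℤ.+ + p ℤ.* + p ℤ.* g′ w)
    critical-expansion r (divides m slope≡mp) with evalZ-taylor h r (+ p)
    ... | h′ , H , expand = g′ , G′ , λ w → begin
      g (r ℤ.+ P ℤ.* w)
        ≡⟨ g≗ _ ⟩
      a ℤ.+ b ℤ.* (r ℤ.+ P ℤ.* w) ℤ.+ c ℤ.* (r ℤ.+ P ℤ.* w) ℤ.* (r ℤ.+ P ℤ.* w) ℤ.+ P ℤ.* evalZ h (r ℤ.+ P ℤ.* w)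
        ≡⟨ ≡.cong (λ z → a ℤ.+ b ℤ.* (r ℤ.+ P ℤ.* w) ℤ.+ c ℤ.* (r ℤ.+ P ℤ.* w) ℤ.* (r ℤ.+ P ℤ.* w) ℤ.+ P ℤ.* z) (expand w) ⟩
      a ℤ.+ b ℤ.* (r ℤ.+ P ℤ.* w) ℤ.+ c ℤ.* (r ℤ.+ P ℤ.* w) ℤ.* (r ℤ.+ P ℤ.* w)
        ℤ.+ P ℤ.* (evalZ h r ℤ.+ h′ ℤ.* P ℤ.* w ℤ.+ P ℤ.* P ℤ.* evalZ H w)
        ≡⟨ regroup a b c r P w (evalZ h r) h′ (evalZ H w) m ⟩
      (a ℤ.+ b ℤ.* r ℤ.+ c ℤ.* r ℤ.* r ℤ.+ P ℤ.* evalZ h r) ℤ.+ P ℤ.* P ℤ.* g′ w ℤ.+ P ℤ.* w ℤ.* (slope r ℤ.- m ℤ.* P)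
        ≡⟨ ≡.cong₂ (λ x z → x ℤ.+ P ℤ.* P ℤ.* g′ w ℤ.+ P ℤ.* w ℤ.* z) (≡.sym (g≗ r)) (ℤP.i≡j⇒i-j≡0 slope≡mp) ⟩
      g r ℤ.+ P ℤ.* P ℤ.* g′ w ℤ.+ P ℤ.* w ℤ.* + 0
        ≡⟨ drop-zero (g r) (P ℤ.* P ℤ.* g′ w) (P ℤ.* w) ⟩
      g r ℤ.+ P ℤ.* P ℤ.* g′ w
        ∎
      where
      open ≡.≡-Reasoning
      P : ℤ
      P = + p
      g′ : ℤ → ℤ
      g′ w = + 0 ℤ.+ (m ℤ.+ h′) ℤ.* w ℤ.+ c ℤ.* w ℤ.* w ℤ.+ P ℤ.* evalZ H w
      G′ : QuadraticPhase p g′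
      G′ = record { a = + 0 ; b = m ℤ.+ h′ ; c = c ; h = H ; p∤c = p∤c ; g≗ = λ _ → ≡.refl }
      regroup : ∀ a b c r P w A h′ Hw m →
        a ℤ.+ b ℤ.* (r ℤ.+ P ℤ.* w) ℤ.+ c ℤ.* (r ℤ.+ P ℤ.* w) ℤ.* (r ℤ.+ P ℤ.* w)
          ℤ.+ P ℤ.* (A ℤ.+ h′ ℤ.* P ℤ.* w ℤ.+ P ℤ.* P ℤ.* Hw)
        ≡ (a ℤ.+ b ℤ.* r ℤ.+ c ℤ.* r ℤ.* r ℤ.+ P ℤ.* A)
          ℤ.+ P ℤ.* P ℤ.* (+ 0 ℤ.+ (m ℤ.+ h′) ℤ.* w ℤ.+ c ℤ.* w ℤ.* w ℤ.+ P ℤ.* Hw)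
          ℤ.+ P ℤ.* w ℤ.* ((b ℤ.+ + 2 ℤ.* c ℤ.* r) ℤ.- m ℤ.* P)
      regroup = solve-∀
      drop-zero : ∀ x y z → x ℤ.+ y ℤ.+ z ℤ.* + 0 ≡ x ℤ.+ y
      drop-zero = solve-∀

    phase-periodic : ∀ T → g (T ℤ.+ + p) ≡ g T mod p
    phase-periodic T = mod-trans (mod-weaken (ℕD.m∣m*n 1) (phase-expand 1 T (+ p) (∣ᵤ⇒∣ (ℕD.1∣ p))))
      (mod-multiple (g T) (∣m∣n⇒∣m+n (∣m⇒∣m*n (slope T) ∣-refl) (∣n⇒∣m*n (c ℤ.* + p) ∣-refl)))

    phase-difference : ∀ t d → g (+ (t ℕ.+ d)) ℤ.- g (+ t) ≡ b ℤ.* + d ℤ.+ c ℤ.* + d ℤ.* + d ℤ.+ + t ℤ.* (+ 2 ℤ.* c ℤ.* + d) mod p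
    phase-difference t d = begin
      g (+ (t ℕ.+ d)) ℤ.- g (+ t)
        ≡⟨ ≡.cong (λ z → g z ℤ.- g (+ t)) (ℤP.pos-+ t d) ⟩
      g (+ t ℤ.+ + d) ℤ.- g (+ t)
        ≈⟨ mod-+ (mod-weaken (ℕD.m∣m*n 1) (phase-expand 1 (+ t) (+ d) (∣ᵤ⇒∣ (ℕD.1∣ d)))) (mod-refl {a = ℤ.- g (+ t)}) ⟩
      g (+ t) ℤ.+ (+ d ℤ.* slope (+ t) ℤ.+ c ℤ.* + d ℤ.* + d) ℤ.- g (+ t)
        ≡⟨ cancel (g (+ t)) b c (+ t) (+ d) ⟩
      b ℤ.* + d ℤ.+ c ℤ.* + d ℤ.* + d ℤ.+ + t ℤ.* (+ 2 ℤ.* c ℤ.* + d)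
        ∎
      where
      open ModReasoning p
      cancel : ∀ x b c t d → x ℤ.+ (d ℤ.* (b ℤ.+ + 2 ℤ.* c ℤ.* t) ℤ.+ c ℤ.* d ℤ.* d) ℤ.- x
                            ≡ b ℤ.* d ℤ.+ c ℤ.* d ℤ.* d ℤ.+ t ℤ.* (+ 2 ℤ.* c ℤ.* d)
      cancel = solve-∀

    slope-periodic : ∀ w r → slope (+ (w ℕ.* p ℕ.+ r)) ≡ slope (+ r) mod p
    slope-periodic w r = begin
      slope (+ (w ℕ.* p ℕ.+ r))                 ≡⟨ ≡.cong slope (pos-affine r p w) ⟩
      slope (+ r ℤ.+ + p ℤ.* + w)               ≡⟨ expand b c (+ r) (+ p) (+ w) ⟩
      slope (+ r) ℤ.+ + 2 ℤ.* c ℤ.* + w ℤ.* + p ≈⟨ mod-multiple (slope (+ r)) (∣n⇒∣m*n (+ 2 ℤ.* c ℤ.* + w) ∣-refl) ⟩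
      slope (+ r)                               ∎
      where
      open ModReasoning p
      expand : ∀ b c r p w → b ℤ.+ + 2 ℤ.* c ℤ.* (r ℤ.+ p ℤ.* w) ≡ b ℤ.+ + 2 ℤ.* c ℤ.* r ℤ.+ + 2 ℤ.* c ℤ.* w ℤ.* p
      expand = solve-∀

    phase-coset : ∀ Q u v → g (+ (v ℕ.* (p ℕ.* Q) ℕ.+ u)) ≡ g (+ u) ℤ.+ + (p ℕ.* Q) ℤ.* (+ v ℤ.* slope (+ u)) mod (p ℕ.* (p ℕ.* Q))
    phase-coset Q u v = begin
      g (+ (v ℕ.* M ℕ.+ u))
        ≡⟨ ≡.cong g (pos-affine u M v) ⟩
      g (+ u ℤ.+ + M ℤ.* + v)
        ≈⟨ phase-expand M (+ u) (+ M ℤ.* + v) (∣m⇒∣m*n (+ v) ∣-refl) ⟩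
      g (+ u) ℤ.+ (+ M ℤ.* + v ℤ.* slope (+ u) ℤ.+ c ℤ.* (+ M ℤ.* + v) ℤ.* (+ M ℤ.* + v))
        ≡⟨ regroup (g (+ u)) (slope (+ u)) c (+ M) (+ v) ⟩
      g (+ u) ℤ.+ + M ℤ.* (+ v ℤ.* slope (+ u)) ℤ.+ c ℤ.* + v ℤ.* + v ℤ.* (+ M ℤ.* + M)
        ≈⟨ mod-multiple _ (∣n⇒∣m*n (c ℤ.* + v ℤ.* + v) n∣M²) ⟩
      g (+ u) ℤ.+ + M ℤ.* (+ v ℤ.* slope (+ u))
        ∎
      where
      open ModReasoning (p ℕ.* (p ℕ.* Q))
      M : ℕ
      M = p ℕ.* Q
      n∣M² : + (p ℕ.* M) ∣ + M ℤ.* + M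
      n∣M² = divides (+ Q) (≡.trans (≡.sym (ℤP.pos-* M M)) (≡.trans (≡.cong +_ (square p Q)) (ℤP.pos-* Q (p ℕ.* M))))
        where
        square : ∀ p Q → p ℕ.* Q ℕ.* (p ℕ.* Q) ≡ Q ℕ.* (p ℕ.* (p ℕ.* Q))
        square = ℕSolver.solve-∀
      regroup : ∀ x s c M v → x ℤ.+ (M ℤ.* v ℤ.* s ℤ.+ c ℤ.* (M ℤ.* v) ℤ.* (M ℤ.* v))
                            ≡ x ℤ.+ M ℤ.* (v ℤ.* s) ℤ.+ c ℤ.* v ℤ.* v ℤ.* (M ℤ.* M)
      regroup = solve-∀

module RootsOfUnity {c ℓ} (R : CommutativeRing c ℓ) where
  open CommutativeRing R
  open RingSums R
  open import Relation.Binary.Reasoning.Setoid setoid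

  infixr 8 _^[_]_
  _^[_]_ : Carrier → ℕ → ℤ → Carrier
  ζ ^[ n ] z = ζ ^ modN z n

  ^[]-cong : ∀ {ζ n} .{{_ : NonZero n}} {a b} → a ≡ b mod n → ζ ^[ n ] a ≈ ζ ^[ n ] b
  ^[]-cong {ζ} a≡b = reflexive (≡.cong (ζ ^_) (modN-cong a≡b))

  ^[1]≈1 : ∀ ζ a → ζ ^[ 1 ] a ≈ 1#
  ^[1]≈1 ζ a = reflexive (≡.cong (ζ ^_) (ℕP.n<1⇒n≡0 (modN-< 1 a)))

  module _ {ζ n} .{{_ : NonZero n}} (ζⁿ≈1 : ζ ^ n ≈ 1#) where

    ^-% : ∀ i → ζ ^ i ≈ ζ ^ (i % n)
    ^-% i = begin
      ζ ^ i                            ≡⟨ ≡.cong (ζ ^_) (m≡m%n+[m/n]*n i n) ⟩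
      ζ ^ (i % n ℕ.+ i / n ℕ.* n)      ≈⟨ ^-homo-* ζ (i % n) _ ⟩
      ζ ^ (i % n) * ζ ^ (i / n ℕ.* n)  ≡⟨ ≡.cong (λ m → ζ ^ (i % n) * ζ ^ m) (ℕP.*-comm (i / n) n) ⟩
      ζ ^ (i % n) * ζ ^ (n ℕ.* (i / n))≈⟨ *-cong refl (^-assocʳ ζ n (i / n)) ⟨
      ζ ^ (i % n) * (ζ ^ n) ^ (i / n)  ≈⟨ *-cong refl (trans (^-congˡ (i / n) ζⁿ≈1) (1#^≈1# (i / n))) ⟩
      ζ ^ (i % n) * 1#                 ≈⟨ *-identityʳ _ ⟩
      ζ ^ (i % n)                      ∎

    ^[]-pos : ∀ i → ζ ^[ n ] + i ≈ ζ ^ i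
    ^[]-pos i = trans (reflexive (≡.cong (ζ ^_) (modN-pos n i))) (sym (^-% i))

    ^[]-+ : ∀ a b → ζ ^[ n ] (a ℤ.+ b) ≈ ζ ^[ n ] a * ζ ^[ n ] b
    ^[]-+ a b = begin
      ζ ^[ n ] (a ℤ.+ b)                       ≈⟨ ^[]-cong (mod-+ (modN-correct n a) (modN-correct n b)) ⟩
      ζ ^[ n ] (+ modN a n ℤ.+ + modN b n)     ≡⟨ ≡.cong (ζ ^[ n ]_) (ℤP.pos-+ (modN a n) (modN b n)) ⟨
      ζ ^[ n ] + (modN a n ℕ.+ modN b n)       ≈⟨ ^[]-pos _ ⟩
      ζ ^ (modN a n ℕ.+ modN b n)              ≈⟨ ^-homo-* ζ (modN a n) (modN b n) ⟩
      ζ ^[ n ] a * ζ ^[ n ] b                  ∎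

    ^[]-≡0 : ∀ {a} → a ≡ + 0 mod n → ζ ^[ n ] a ≈ 1#
    ^[]-≡0 a≡0 = trans (^[]-cong a≡0) (^[]-pos 0)

    ^[]-inverse : ∀ a → ζ ^[ n ] a * ζ ^[ n ] (ℤ.- a) ≈ 1#
    ^[]-inverse a = trans (sym (^[]-+ a (ℤ.- a))) (^[]-≡0 (mod-reflexive (ℤP.+-inverseʳ a)))

  ^[]-^ : ∀ {ζ} m Q .{{_ : NonZero m}} .{{_ : NonZero Q}} → ζ ^ (m ℕ.* Q) ≈ 1# →
    ∀ y → (ζ ^ m) ^[ Q ] y ≈ ζ ^[ m ℕ.* Q ] (+ m ℤ.* y)
  ^[]-^ {ζ} m Q ζ^mQ≈1 y = begin
    (ζ ^ m) ^ modN y Q                     ≈⟨ ^-assocʳ ζ m (modN y Q) ⟩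
    ζ ^ (m ℕ.* modN y Q)                   ≈⟨ ^[]-pos {n = m ℕ.* Q} ζ^mQ≈1 _ ⟨
    ζ ^[ m ℕ.* Q ] + (m ℕ.* modN y Q)      ≡⟨ ≡.cong (ζ ^[ m ℕ.* Q ]_) (ℤP.pos-* m (modN y Q)) ⟩
    ζ ^[ m ℕ.* Q ] (+ m ℤ.* + modN y Q)    ≈⟨ ^[]-cong (mod-scale m (mod-sym (modN-correct Q y))) ⟩
    ζ ^[ m ℕ.* Q ] (+ m ℤ.* y)             ∎
    where instance _ = ℕP.m*n≢0 m Q

module GaussSums {ℓ₁ ℓ} (R : CommutativeRing ℓ₁ ℓ) {p : ℕ} (p-prime : Prime p) (p≢2 : p ≢ 2) where
  open CommutativeRing R
  open RingSums R
  open RootsOfUnity R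
  open import Data.Integer.Divisibility.Signed using (_∣_; ∣⇒∣ᵤ; ∣ᵤ⇒∣; ∣n⇒∣m*n; *-monoʳ-∣; ∣-trans; ∣-refl; ∣m⇒∣-m)
  open import Relation.Binary.Reasoning.Setoid setoid

  instance
    p≢0 : NonZero p
    p≢0 = prime⇒nonZero p-prime

  gaussSum : ℕ → Carrier → (ℤ → ℤ) → Carrier
  gaussSum n ζ g = Σ n (λ t → ζ ^[ n ] g (+ t))

  -- Φ_{p^k}(ζ) ≈ 0, for Φ_{p^k} as in cyclotomicPP.
  RootOfΦ : ℕ → Carrier → Set ℓ
  RootOfΦ zero    ζ = ζ ≈ 1#
  RootOfΦ (suc k) ζ = Σ p (λ i → ζ ^ (i ℕ.* p ℕ.^ k)) ≈ 0#

  root-Σ : ∀ k {ζ} → RootOfΦ (suc k) ζ → Σ p ((ζ ^ p ℕ.^ k) ^_) ≈ 0#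
  root-Σ k {ζ} Φζ≈0 = trans (Σ-cong p (λ i → trans (^-assocʳ ζ (p ℕ.^ k) i) (reflexive (≡.cong (ζ ^_) (ℕP.*-comm (p ℕ.^ k) i))))) Φζ≈0

  root⇒^≈1 : ∀ k {ζ} → RootOfΦ k ζ → ζ ^ (p ℕ.^ k) ≈ 1#
  root⇒^≈1 zero    ζ≈1     = trans (*-identityʳ _) ζ≈1
  root⇒^≈1 (suc k) {ζ} Φζ≈0 = begin
    ζ ^ (p ℕ.* p ℕ.^ k)   ≡⟨ ≡.cong (ζ ^_) (ℕP.*-comm p (p ℕ.^ k)) ⟩
    ζ ^ (p ℕ.^ k ℕ.* p)   ≈⟨ ^-assocʳ ζ (p ℕ.^ k) p ⟨
    (ζ ^ p ℕ.^ k) ^ p     ≈⟨ Σ^≈0⇒^≈1 p _ (root-Σ k Φζ≈0) ⟩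
    1#                    ∎

  root-descends : ∀ k {ζ} → RootOfΦ (2 ℕ.+ k) ζ → RootOfΦ k (ζ ^ (p ℕ.* p))
  root-descends zero    {ζ} Φζ≈0 = trans (reflexive (≡.cong (ζ ^_) (≡.cong (p ℕ.*_) (≡.sym (ℕP.*-identityʳ p))))) (root⇒^≈1 2 Φζ≈0)
  root-descends (suc k) {ζ} Φζ≈0 = trans (Σ-cong p (λ i → trans (^-assocʳ ζ (p ℕ.* p) _) (reflexive (≡.cong (ζ ^_) (exponent p i (p ℕ.^ k)))))) Φζ≈0
    where
    exponent : ∀ p i q → p ℕ.* p ℕ.* (i ℕ.* q) ≡ i ℕ.* (p ℕ.* (p ℕ.* q))
    exponent = ℕSolver.solve-∀

  -- v ↦ v e mod p permutes [0, p), which turns the sum into Φ_{p^{k+1}}(ζ).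
  character-sum : ∀ k {ζ} → RootOfΦ (suc k) ζ → ∀ e → ¬ + p ∣ e →
    Σ p (λ v → ζ ^[ p ℕ.^ suc k ] (+ (p ℕ.^ k) ℤ.* (+ v ℤ.* e))) ≈ 0#
  character-sum k {ζ} Φζ≈0 e p∤e with inverse p-prime e p∤e
  ... | e′ , e′e≡1 = begin
    Σ p (λ v → ζ ^[ p ℕ.^ suc k ] (+ (p ℕ.^ k) ℤ.* (+ v ℤ.* e)))  ≈⟨ Σ-cong p (λ v → sym (term v)) ⟩
    Σ p (λ v → ω ^ σ v)                                            ≈⟨ Σ-permute p (ω ^_) σ τ (λ _ _ → modN-< p _) (λ _ _ → modN-< p _)
                                                                         (λ _ → modN-*-inverse e′e≡1) (λ _ → modN-*-inverse ee′≡1) ⟩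
    Σ p (ω ^_)                                                     ≈⟨ root-Σ k Φζ≈0 ⟩
    0#                                                             ∎
    where
    instance _ = ℕP.m^n≢0 p k
    ω : Carrier
    ω = ζ ^ p ℕ.^ k
    σ τ : ℕ → ℕ
    σ v = modN (+ v ℤ.* e) p
    τ u = modN (+ u ℤ.* e′) p
    ee′≡1 : e ℤ.* e′ ≡ + 1 mod p
    ee′≡1 = ≡.subst (_≡ + 1 mod p) (ℤP.*-comm e′ e) e′e≡1
    term : ∀ v → ω ^[ p ] (+ v ℤ.* e) ≈ ζ ^[ p ℕ.^ suc k ] (+ (p ℕ.^ k) ℤ.* (+ v ℤ.* e))
    term v = trans (^[]-^ (p ℕ.^ k) p (trans (reflexive (≡.cong (ζ ^_) (ℕP.*-comm (p ℕ.^ k) p))) (root⇒^≈1 (suc k) Φζ≈0)) (+ v ℤ.* e))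
                   (reflexive (≡.cong (λ n → ζ ^[ n ] (+ (p ℕ.^ k) ℤ.* (+ v ℤ.* e))) (ℕP.*-comm (p ℕ.^ k) p)))

  p∤2c : ∀ {c} → ¬ + p ∣ c → ¬ + p ∣ + 2 ℤ.* c
  p∤2c p∤c p∣2c with prime∣*⇒∣⊎∣ p-prime (+ 2) _ p∣2c
  ... | inj₁ p∣2 = p≢2 (ℕP.≤-antisym (ℕD.∣⇒≤ (∣⇒∣ᵤ p∣2)) (ℕ.nonTrivial⇒n>1 p {{prime⇒nonTrivial p-prime}}))
  ... | inj₂ p∣c = p∤c p∣c

  gaussSum-norm₀ : ∀ ζ g → gaussSum 1 ζ g * gaussSum 1 ζ (ℤ.-_ ∘ g) ≈ ι 1
  gaussSum-norm₀ ζ g = begin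
    (ζ ^[ 1 ] g (+ 0) + 0#) * (ζ ^[ 1 ] ℤ.- g (+ 0) + 0#)   ≈⟨ *-cong (+-cong (^[1]≈1 ζ (g (+ 0))) refl) (+-cong (^[1]≈1 ζ (ℤ.- g (+ 0))) refl) ⟩
    (1# + 0#) * (1# + 0#)                                 ≈⟨ trans (*-cong (+-identityʳ 1#) refl) (*-identityˡ _) ⟩
    1# + 0#                                               ∎

  -- With s = t + d, the phase difference g s − g t is linear in t mod p, so the sum over t vanishes unless d = 0.
  gaussSum-prime : ∀ {ζ} → ζ ^ p ≈ 1# → (∀ e → ¬ + p ∣ e → Σ p (λ v → ζ ^[ p ] (+ v ℤ.* e)) ≈ 0#) →
    ∀ {g} → QuadraticPhase p g → gaussSum p ζ g * gaussSum p ζ (ℤ.-_ ∘ g) ≈ ι p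
  gaussSum-prime {ζ} ζᵖ≈1 vanishes {g} G = begin
    gaussSum p ζ g * gaussSum p ζ (ℤ.-_ ∘ g)
      ≈⟨ trans (Σ-distribʳ p _ _) (Σ-cong p (λ s → trans (Σ-distribˡ p _ _) (Σ-cong p (λ t → sym (^[]-+ ζᵖ≈1 _ _))))) ⟩
    Σ p (λ s → Σ p (λ t → F s t))
      ≈⟨ Σ-swap p p F ⟩
    Σ p (λ t → Σ p (λ s → F s t))
      ≈⟨ Σ-cong p (λ t → sym (Σ-periodic p (λ s → F s t) (λ s → ^[]-cong (mod-+ (periodic s) (mod-refl {a = ℤ.- g (+ t)}))) t)) ⟩
    Σ p (λ t → Σ p (λ d → F (t ℕ.+ d) t))
      ≈⟨ Σ-cong p (λ t → Σ-cong p (λ d → difference t d)) ⟩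
    Σ p (λ t → Σ p (λ d → ζ ^[ p ] A d * ζ ^[ p ] (+ t ℤ.* E d)))
      ≈⟨ Σ-swap p p _ ⟩
    Σ p (λ d → Σ p (λ t → ζ ^[ p ] A d * ζ ^[ p ] (+ t ℤ.* E d)))
      ≈⟨ Σ-cong p (λ d → sym (Σ-distribˡ p _ _)) ⟩
    Σ p (λ d → ζ ^[ p ] A d * Σ p (λ t → ζ ^[ p ] (+ t ℤ.* E d)))
      ≈⟨ Σ-single p _ 0 (ℕ.>-nonZero⁻¹ p) (λ d d<p d≢0 → trans (*-cong refl (vanishes (E d) (p∤E d<p d≢0))) (zeroʳ _)) ⟩
    ζ ^[ p ] A 0 * Σ p (λ t → ζ ^[ p ] (+ t ℤ.* E 0))
      ≈⟨ *-cong (^[]-≡0 ζᵖ≈1 (mod-reflexive (A0≡0 b c))) (Σ-cong p (λ t → ^[]-≡0 ζᵖ≈1 (mod-reflexive (E0≡0 (+ t) c)))) ⟩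
    1# * Σ p (λ _ → 1#)
      ≈⟨ trans (*-identityˡ _) (Σ-1 p) ⟩
    ι p
      ∎
    where
    open QuadraticPhase G
    F : ℕ → ℕ → Carrier
    F s t = ζ ^[ p ] (g (+ s) ℤ.- g (+ t))
    A E : ℕ → ℤ
    A d = b ℤ.* + d ℤ.+ c ℤ.* + d ℤ.* + d
    E d = + 2 ℤ.* c ℤ.* + d
    periodic : ∀ s → g (+ (s ℕ.+ p)) ≡ g (+ s) mod p
    periodic s = ≡.subst (λ z → g z ≡ g (+ s) mod p) (≡.sym (ℤP.pos-+ s p)) (phase-periodic G (+ s))
    difference : ∀ t d → F (t ℕ.+ d) t ≈ ζ ^[ p ] A d * ζ ^[ p ] (+ t ℤ.* E d)
    difference t d = trans (^[]-cong (phase-difference G t d)) (^[]-+ ζᵖ≈1 _ _)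
    p∤E : ∀ {d} → d < p → d ≢ 0 → ¬ + p ∣ E d
    p∤E {d} d<p d≢0 p∣E with prime∣*⇒∣⊎∣ p-prime (+ 2 ℤ.* c) (+ d) p∣E
    ... | inj₁ p∣2c = p∤2c p∤c p∣2c
    ... | inj₂ p∣d  = d≢0 (residue-unique d<p (ℕ.>-nonZero⁻¹ p) (mod-intro (≡.subst (+ p ∣_) (≡.sym (ℤP.+-identityʳ (+ d))) p∣d)))
    A0≡0 : ∀ b c → b ℤ.* + 0 ℤ.+ c ℤ.* + 0 ℤ.* + 0 ≡ + 0
    A0≡0 = solve-∀
    E0≡0 : ∀ t c → t ℤ.* (+ 2 ℤ.* c ℤ.* + 0) ≡ + 0
    E0≡0 = solve-∀

  -- Summing over the cosets u + p^{K+1} v first leaves Σ_u ζ^{g u} slopeSum u; slopeSum u vanishes unless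
  -- u ≡ r₀ (mod p), and on u = r₀ + p w the phase is g r₀ + p² g′ w.
  module _ (K : ℕ) {ζ : Carrier} (Φζ≈0 : RootOfΦ (2 ℕ.+ K) ζ) {g : ℤ → ℤ} (G : QuadraticPhase p g)
           {r₀ : ℕ} (r₀<p : r₀ < p) (p∣slope[r₀] : + p ∣ QuadraticPhase.slope G (+ r₀)) where
    open QuadraticPhase G
    private
      instance _ = ℕP.m^n≢0 p K
      instance _ = ℕP.m^n≢0 p (suc K)
      instance _ = ℕP.m^n≢0 p (2 ℕ.+ K)
      Q M n : ℕ
      Q = p ℕ.^ K
      M = p ℕ.* Q
      n = p ℕ.* M
      ζⁿ≈1 : ζ ^ n ≈ 1#
      ζⁿ≈1 = root⇒^≈1 (2 ℕ.+ K) Φζ≈0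

    slopeSum : ℕ → Carrier
    slopeSum u = Σ p (λ v → ζ ^[ n ] (+ M ℤ.* (+ v ℤ.* slope (+ u))))

    coset-sum : ∀ u → Σ p (λ v → ζ ^[ n ] g (+ (v ℕ.* M ℕ.+ u))) ≈ ζ ^[ n ] g (+ u) * slopeSum u
    coset-sum u = trans (Σ-cong p (λ v → trans (^[]-cong (phase-coset G Q u v)) (^[]-+ ζⁿ≈1 _ _))) (sym (Σ-distribˡ p _ _))

    slopeSum-off-critical : ∀ w {r} → r < p → r ≢ r₀ → slopeSum (w ℕ.* p ℕ.+ r) ≈ 0#
    slopeSum-off-critical w {r} r<p r≢r₀ = character-sum (suc K) Φζ≈0 _ (λ p∣slope → r≢r₀
      (linear-root-unique p-prime (+ 2 ℤ.* c) (p∤2c p∤c) b r<p r₀<p (mod-∣ (mod-sym (slope-periodic G w r)) p∣slope) p∣slope[r₀]))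

    slopeSum-critical : ∀ w → slopeSum (w ℕ.* p ℕ.+ r₀) ≈ ι p
    slopeSum-critical w = trans (Σ-cong p (λ v → ^[]-≡0 ζⁿ≈1 (mod-intro (≡.subst (+ n ∣_) (≡.sym (ℤP.+-identityʳ _)) (n∣M*v*e v))))) (Σ-1 p)
      where
      p∣s : + p ∣ slope (+ (w ℕ.* p ℕ.+ r₀))
      p∣s = mod-∣ (slope-periodic G w r₀) p∣slope[r₀]
      n∣M*v*e : ∀ v → + n ∣ + M ℤ.* (+ v ℤ.* slope (+ (w ℕ.* p ℕ.+ r₀)))
      n∣M*v*e v = ∣-trans (≡.subst (_∣ + M ℤ.* slope (+ (w ℕ.* p ℕ.+ r₀))) M*p≡n (*-monoʳ-∣ (+ M) p∣s))
                          (*-monoʳ-∣ (+ M) (∣n⇒∣m*n (+ v) ∣-refl))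
        where
        M*p≡n : + M ℤ.* + p ≡ + n
        M*p≡n = ≡.trans (≡.sym (ℤP.pos-* M p)) (≡.cong +_ (ℕP.*-comm M p))

    module _ {g′ : ℤ → ℤ} (expansion : ∀ w → g (+ r₀ ℤ.+ + p ℤ.* w) ≡ g (+ r₀) ℤ.+ + p ℤ.* + p ℤ.* g′ w) where
      private
        η : Carrier
        η = ζ ^ (p ℕ.* p)
        F : ℕ → Carrier
        F u = ζ ^[ n ] g (+ u) * slopeSum u

      η^[Q]≈ζ^[n] : ∀ y → η ^[ Q ] y ≈ ζ ^[ n ] (+ p ℤ.* + p ℤ.* y)
      η^[Q]≈ζ^[n] y = trans (^[]-^ (p ℕ.* p) Q (trans (reflexive (≡.cong (ζ ^_) (ℕP.*-assoc p p Q))) ζⁿ≈1) y)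
        (reflexive (≡.cong₂ (λ m z → ζ ^[ m ] z) (ℕP.*-assoc p p Q) (≡.cong (ℤ._* y) (ℤP.pos-* p p))))
        where instance _ = ℕP.m*n≢0 p p

      fibre-critical : ∀ w → F (w ℕ.* p ℕ.+ r₀) ≈ ι p * (ζ ^[ n ] g (+ r₀) * η ^[ Q ] g′ (+ w))
      fibre-critical w = begin
        ζ ^[ n ] g (+ (w ℕ.* p ℕ.+ r₀)) * slopeSum (w ℕ.* p ℕ.+ r₀)
          ≈⟨ *-cong (reflexive (≡.cong (ζ ^[ n ]_) (≡.trans (≡.cong g (pos-affine r₀ p w)) (expansion (+ w))))) (slopeSum-critical w) ⟩
        ζ ^[ n ] (g (+ r₀) ℤ.+ + p ℤ.* + p ℤ.* g′ (+ w)) * ι p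
          ≈⟨ *-cong (trans (^[]-+ ζⁿ≈1 _ _) (*-cong refl (sym (η^[Q]≈ζ^[n] (g′ (+ w)))))) refl ⟩
        (ζ ^[ n ] g (+ r₀) * η ^[ Q ] g′ (+ w)) * ι p
          ≈⟨ *-comm _ _ ⟩
        ι p * (ζ ^[ n ] g (+ r₀) * η ^[ Q ] g′ (+ w))
          ∎

      reduction : gaussSum n ζ g ≈ ι p * (ζ ^[ n ] g (+ r₀) * gaussSum Q η g′)
      reduction = begin
        Σ (p ℕ.* M) (λ t → ζ ^[ n ] g (+ t))
          ≈⟨ Σ-* p M _ ⟩
        Σ p (λ v → Σ M (λ u → ζ ^[ n ] g (+ (v ℕ.* M ℕ.+ u))))
          ≈⟨ Σ-swap p M _ ⟩
        Σ M (λ u → Σ p (λ v → ζ ^[ n ] g (+ (v ℕ.* M ℕ.+ u))))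
          ≈⟨ Σ-cong M coset-sum ⟩
        Σ M F
          ≡⟨ ≡.cong (λ m → Σ m F) (ℕP.*-comm p Q) ⟩
        Σ (Q ℕ.* p) F
          ≈⟨ Σ-* Q p F ⟩
        Σ Q (λ w → Σ p (λ r → F (w ℕ.* p ℕ.+ r)))
          ≈⟨ Σ-swap Q p _ ⟩
        Σ p (λ r → Σ Q (λ w → F (w ℕ.* p ℕ.+ r)))
          ≈⟨ Σ-single p _ r₀ r₀<p (λ r r<p r≢r₀ → Σ-zero Q _ (λ w _ → trans (*-cong refl (slopeSum-off-critical w r<p r≢r₀)) (zeroʳ _))) ⟩
        Σ Q (λ w → F (w ℕ.* p ℕ.+ r₀))
          ≈⟨ Σ-cong Q fibre-critical ⟩
        Σ Q (λ w → ι p * (ζ ^[ n ] g (+ r₀) * η ^[ Q ] g′ (+ w)))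
          ≈⟨ trans (sym (Σ-distribˡ Q _ _)) (*-cong refl (sym (Σ-distribˡ Q _ _))) ⟩
        ι p * (ζ ^[ n ] g (+ r₀) * gaussSum Q η g′)
          ∎

  gaussSum-norm₁ : ∀ {ζ} → RootOfΦ 1 ζ → ∀ {g} → QuadraticPhase p g →
    gaussSum (p ℕ.^ 1) ζ g * gaussSum (p ℕ.^ 1) ζ (ℤ.-_ ∘ g) ≈ ι (p ℕ.^ 1)
  gaussSum-norm₁ {ζ} Φζ≈0 {g} G rewrite ℕP.*-identityʳ p = gaussSum-prime ζᵖ≈1 vanishes G
    where
    ζᵖ≈1 : ζ ^ p ≈ 1#
    ζᵖ≈1 = trans (reflexive (≡.cong (ζ ^_) (≡.sym (ℕP.*-identityʳ p)))) (root⇒^≈1 1 Φζ≈0)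
    vanishes : ∀ e → ¬ + p ∣ e → Σ p (λ v → ζ ^[ p ] (+ v ℤ.* e)) ≈ 0#
    vanishes e p∤e = trans (Σ-cong p (λ v → reflexive (≡.cong₂ (λ m z → ζ ^[ m ] z) (≡.sym (ℕP.*-identityʳ p)) (≡.sym (ℤP.*-identityˡ _)))))
                           (character-sum 0 Φζ≈0 e p∤e)

  private
    gaussSum-norm-step : ∀ K {ζ} → RootOfΦ (2 ℕ.+ K) ζ → ∀ {g} (G : QuadraticPhase p g) {r₀} → r₀ < p →
      (p∣slope : + p ∣ QuadraticPhase.slope G (+ r₀)) → ∀ {g′} → QuadraticPhase p g′ →
      (∀ w → g (+ r₀ ℤ.+ + p ℤ.* w) ≡ g (+ r₀) ℤ.+ + p ℤ.* + p ℤ.* g′ w) →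
      gaussSum (p ℕ.^ K) (ζ ^ (p ℕ.* p)) g′ * gaussSum (p ℕ.^ K) (ζ ^ (p ℕ.* p)) (ℤ.-_ ∘ g′) ≈ ι (p ℕ.^ K) →
      gaussSum (p ℕ.^ (2 ℕ.+ K)) ζ g * gaussSum (p ℕ.^ (2 ℕ.+ K)) ζ (ℤ.-_ ∘ g) ≈ ι (p ℕ.^ (2 ℕ.+ K))
    gaussSum-norm-step K {ζ} Φζ≈0 {g} G {r₀} r₀<p p∣slope {g′} G′ expansion IH = begin
      gaussSum n ζ g * gaussSum n ζ (ℤ.-_ ∘ g)
        ≈⟨ *-cong (reduction K Φζ≈0 G r₀<p p∣slope expansion) (reduction K Φζ≈0 (phase-neg G) r₀<p p∣-slope -expansion) ⟩
      (ι p * (Z * S′ g′)) * (ι p * (Z⁻ * S′ (ℤ.-_ ∘ g′)))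
        ≈⟨ trans (interchange (ι p) (Z * S′ g′) (ι p) (Z⁻ * S′ (ℤ.-_ ∘ g′))) (*-cong refl (interchange Z (S′ g′) Z⁻ (S′ (ℤ.-_ ∘ g′)))) ⟩
      (ι p * ι p) * ((Z * Z⁻) * (S′ g′ * S′ (ℤ.-_ ∘ g′)))
        ≈⟨ *-cong refl (*-cong (^[]-inverse (root⇒^≈1 (2 ℕ.+ K) Φζ≈0) (g (+ r₀))) IH) ⟩
      (ι p * ι p) * (1# * ι (p ℕ.^ K))
        ≈⟨ trans (*-assoc (ι p) (ι p) _) (*-cong refl (trans (*-cong refl (*-identityˡ _)) (sym (ι-* p (p ℕ.^ K))))) ⟩
      ι p * ι (p ℕ.* p ℕ.^ K)
        ≈⟨ ι-* p (p ℕ.* p ℕ.^ K) ⟨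
      ι n
        ∎
      where
      open import Algebra.Properties.CommutativeSemigroup *-commutativeSemigroup using (interchange)
      instance _ = ℕP.m^n≢0 p (2 ℕ.+ K)
      n : ℕ
      n = p ℕ.^ (2 ℕ.+ K)
      Z Z⁻ : Carrier
      Z  = ζ ^[ n ] g (+ r₀)
      Z⁻ = ζ ^[ n ] ℤ.- g (+ r₀)
      S′ : (ℤ → ℤ) → Carrier
      S′ = gaussSum (p ℕ.^ K) (ζ ^ (p ℕ.* p))
      p∣-slope : + p ∣ QuadraticPhase.slope (phase-neg G) (+ r₀)
      p∣-slope = ≡.subst (+ p ∣_) (negate (QuadraticPhase.b G) (QuadraticPhase.c G) (+ r₀)) (∣m⇒∣-m p∣slope)
        where
        negate : ∀ b c r → ℤ.- (b ℤ.+ + 2 ℤ.* c ℤ.* r) ≡ ℤ.- b ℤ.+ + 2 ℤ.* ℤ.- c ℤ.* r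
        negate = solve-∀
      -expansion : ∀ w → ℤ.- g (+ r₀ ℤ.+ + p ℤ.* w) ≡ ℤ.- g (+ r₀) ℤ.+ + p ℤ.* + p ℤ.* ℤ.- g′ w
      -expansion w = ≡.trans (≡.cong ℤ.-_ (expansion w)) (negate (g (+ r₀)) (+ p) (g′ w))
        where
        negate : ∀ x P y → ℤ.- (x ℤ.+ P ℤ.* P ℤ.* y) ≡ ℤ.- x ℤ.+ P ℤ.* P ℤ.* ℤ.- y
        negate = solve-∀

  critical-point : ∀ {g} (G : QuadraticPhase p g) → ∃ λ r₀ → r₀ < p × + p ∣ QuadraticPhase.slope G (+ r₀)
  critical-point G = linear-root p-prime (+ 2 ℤ.* c) (p∤2c p∤c) b
    where open QuadraticPhase G

  gaussSum-norm : ∀ k {ζ} → RootOfΦ k ζ → ∀ {g} → QuadraticPhase p g →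
    gaussSum (p ℕ.^ k) ζ g * gaussSum (p ℕ.^ k) ζ (ℤ.-_ ∘ g) ≈ ι (p ℕ.^ k)
  gaussSum-norm zero          _    {g} _ = gaussSum-norm₀ _ g
  gaussSum-norm (suc zero)    Φζ≈0     G = gaussSum-norm₁ Φζ≈0 G
  gaussSum-norm (suc (suc K)) {ζ} Φζ≈0 {g} G = descend (critical-point G)
    where
    descend : (∃ λ r₀ → r₀ < p × + p ∣ QuadraticPhase.slope G (+ r₀)) →
      gaussSum (p ℕ.^ (2 ℕ.+ K)) ζ g * gaussSum (p ℕ.^ (2 ℕ.+ K)) ζ (ℤ.-_ ∘ g) ≈ ι (p ℕ.^ (2 ℕ.+ K))
    descend (r₀ , r₀<p , p∣slope) =
      let g′ , G′ , expansion = critical-expansion G (+ r₀) p∣slope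
      in gaussSum-norm-step K Φζ≈0 G r₀<p p∣slope G′ expansion (gaussSum-norm K (root-descends K Φζ≈0) G′)

odd⇒suc[h+h] : ∀ n → n % 2 ≡ 1 → n ≡ suc (n / 2 ℕ.+ n / 2)
odd⇒suc[h+h] n n%2≡1 = ≡.trans (m≡m%n+[m/n]*n n 2)
  (≡.cong₂ ℕ._+_ n%2≡1 (≡.trans (ℕP.*-comm (n / 2) 2) (≡.cong (n / 2 ℕ.+_) (ℕP.+-identityʳ (n / 2)))))

^-odd : ∀ {n} → n % 2 ≡ 1 → ∀ k → n ℕ.^ k % 2 ≡ 1
^-odd n%2≡1 zero    = ≡.refl
^-odd {n} n%2≡1 (suc k) = ≡.trans (%-distribˡ-* n (n ℕ.^ k) 2) (≡.cong₂ (λ x y → x ℕ.* y % 2) n%2≡1 (^-odd n%2≡1 k))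

module _ {p : ℕ} (p-prime : Prime p) where
  open import Data.Nat.Divisibility using (_∣_; _∣?_; ∣-trans; ∣1⇒≡1; m∣m*n; n∣m*n; ∣m+n∣m⇒∣n; _∣0; ∣⇒≤; divides)
  open RangeFold ℕP.+-0-commutativeMonoid using (fold; fold-cong<; fold-*; fold-∙; fold-pairs)

  prime≢2⇒odd : p ≢ 2 → p % 2 ≡ 1
  prime≢2⇒odd p≢2 with p % 2 in p%2≡ | m%n<n p 2
  ... | 0 | _ with prime⇒irreducible p-prime (divides (p / 2) (≡.trans (m≡m%n+[m/n]*n p 2) (≡.cong (ℕ._+ p / 2 ℕ.* 2) p%2≡)))
  ...   | inj₁ ()
  ...   | inj₂ 2≡p = ⊥-elim (p≢2 (≡.sym 2≡p))
  prime≢2⇒odd p≢2 | 1 | _ = ≡.refl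
  prime≢2⇒odd p≢2 | suc (suc _) | s≤s (s≤s ())

  coprime-^ : ∀ {j} → ¬ p ∣ j → ∀ k → Coprime j (p ℕ.^ k)
  coprime-^ p∤j zero    (_ , d∣1)         = ∣1⇒≡1 d∣1
  coprime-^ {j} p∤j (suc k) {d} (d∣j , d∣pq) = coprime-^ p∤j k (d∣j , coprime-divisor coprime[d,p] d∣pq)
    where
    coprime[d,p] : Coprime d p
    coprime[d,p] (x∣d , x∣p) = prime∤⇒coprime p-prime p∤j (x∣p , ∣-trans x∣d d∣j)

  module Units (K : ℕ) where
    private
      n : ℕ
      n = p ℕ.^ suc K
      instance _ = prime⇒nonZero p-prime
      p∣ : ∀ {j} → j ≡ n → p ∣ j
      p∣ j≡n = ≡.subst (p ∣_) (≡.sym j≡n) (m∣m*n (p ℕ.^ K))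

    -- The filter of galoisExps n; does (gcd j n ℕ.≟ 1) reduces to it, which is how dec-true/dec-false apply.
    isUnit : ℕ → Bool
    isUnit j = gcd j n ℕ.≡ᵇ 1

    isUnit-∤ : ∀ {j} → ¬ p ∣ j → isUnit j ≡ true
    isUnit-∤ {j} p∤j = dec-true (gcd j n ℕ.≟ 1) (coprime⇒gcd≡1 (coprime-^ p∤j (suc K)))

    isUnit-∣ : ∀ {j} → p ∣ j → isUnit j ≡ false
    isUnit-∣ {j} p∣j = dec-false (gcd j n ℕ.≟ 1) (λ gcd≡1 → ℕP.<⇒≢ (ℕ.nonTrivial⇒n>1 p {{prime⇒nonTrivial p-prime}})
      (≡.sym (∣1⇒≡1 (≡.subst (p ∣_) gcd≡1 (gcd-greatest p∣j (m∣m*n (p ℕ.^ K)))))))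

    isUnit-mirror : ∀ {j j′} → j ℕ.+ j′ ≡ n → isUnit j ≡ isUnit j′
    isUnit-mirror {j} {j′} j+j′≡n with p ∣? j
    ... | yes p∣j = ≡.trans (isUnit-∣ p∣j) (≡.sym (isUnit-∣ (∣m+n∣m⇒∣n (p∣ j+j′≡n) p∣j)))
    ... | no p∤j  = ≡.trans (isUnit-∤ p∤j) (≡.sym (isUnit-∤ (p∤j ∘ ∣m+n∣m⇒∣n (p∣ (≡.trans (ℕP.+-comm j′ j) j+j′≡n)))))

    isUnit-0 : isUnit 0 ≡ false
    isUnit-0 = isUnit-∣ (p ∣0)

    count-units : count n isUnit ≡ p ℕ.^ K ℕ.* (p ℕ.∸ 1)
    count-units = begin
      count (p ℕ.* p ℕ.^ K) isUnit                              ≡⟨ ≡.cong (λ m → count m isUnit) (ℕP.*-comm p (p ℕ.^ K)) ⟩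
      count (p ℕ.^ K ℕ.* p) isUnit                              ≡⟨ fold-* (p ℕ.^ K) p _ ⟩
      fold (p ℕ.^ K) (λ w → count p (λ r → isUnit (w ℕ.* p ℕ.+ r)))  ≡⟨ fold-cong< (p ℕ.^ K) (λ w _ → count-block w) ⟩
      fold (p ℕ.^ K) (λ _ → p ℕ.∸ 1)                            ≡⟨ fold-const (p ℕ.^ K) (p ℕ.∸ 1) ⟩
      p ℕ.^ K ℕ.* (p ℕ.∸ 1)                                     ∎
      where
      open ≡.≡-Reasoning
      fold-const : ∀ q c → fold q (λ _ → c) ≡ q ℕ.* c
      fold-const zero    c = ≡.refl
      fold-const (suc q) c = ≡.cong (c ℕ.+_) (fold-const q c)
      count-block : ∀ w → count p (λ r → isUnit (w ℕ.* p ℕ.+ r)) ≡ p ℕ.∸ 1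
      count-block w = ≡.subst (λ P → count P f ≡ P ℕ.∸ 1) (ℕP.suc-pred p) (begin
        (if f 0 then 1 else 0) ℕ.+ count (ℕ.pred p) (f ∘ suc)     ≡⟨ ≡.cong₂ ℕ._+_ (≡.cong (if_then 1 else 0) f0≡false)
                                                                        (fold-cong< (ℕ.pred p) (λ i i<p-1 → ≡.cong (if_then 1 else 0) (f[1+i]≡true i<p-1))) ⟩
        fold (ℕ.pred p) (λ _ → 1)                               ≡⟨ fold-const (ℕ.pred p) 1 ⟩
        ℕ.pred p ℕ.* 1                                          ≡⟨ ℕP.*-identityʳ _ ⟩
        ℕ.pred p                                                ∎)
        where
        f : ℕ → Bool
        f r = isUnit (w ℕ.* p ℕ.+ r)
        p∣wp : p ∣ w ℕ.* p
        p∣wp = n∣m*n w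
        f0≡false : f 0 ≡ false
        f0≡false = isUnit-∣ (≡.subst (p ∣_) (≡.sym (ℕP.+-identityʳ _)) p∣wp)
        f[1+i]≡true : ∀ {i} → i < ℕ.pred p → f (suc i) ≡ true
        f[1+i]≡true {i} i<p-1 = isUnit-∤ (λ p∣ → ℕP.<⇒≱ (≡.subst (suc i <_) (ℕP.suc-pred p) (s≤s i<p-1)) (∣⇒≤ (∣m+n∣m⇒∣n p∣ p∣wp)))

    count-half-units : ∀ {m} → n ≡ suc (m ℕ.+ m) → count m (isUnit ∘ suc) ℕ.+ count m (isUnit ∘ suc) ≡ count n isUnit
    count-half-units {m} n≡2m+1 = ≡.sym (begin
      count n isUnit                                               ≡⟨ ≡.cong (λ N → count N isUnit) n≡2m+1 ⟩
      count (suc (m ℕ.+ m)) isUnit                                 ≡⟨ fold-pairs m (ind ∘ isUnit) ⟩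
      ind (isUnit 0) ℕ.+ fold m (λ i → ind (isUnit (suc i)) ℕ.+ ind (isUnit (m ℕ.+ m ℕ.∸ i)))
        ≡⟨ ≡.cong₂ ℕ._+_ (≡.cong ind isUnit-0) (fold-cong< m (λ i i<m → ≡.cong (ind (isUnit (suc i)) ℕ.+_) (≡.cong ind (≡.sym (mirror i<m))))) ⟩
      fold m (λ i → ind (isUnit (suc i)) ℕ.+ ind (isUnit (suc i)))  ≡⟨ fold-∙ m (ind ∘ isUnit ∘ suc) (ind ∘ isUnit ∘ suc) ⟩
      count m (isUnit ∘ suc) ℕ.+ count m (isUnit ∘ suc)            ∎)
      where
      open ≡.≡-Reasoning
      ind : Bool → ℕ
      ind b = if b then 1 else 0
      mirror : ∀ {i} → i < m → isUnit (suc i) ≡ isUnit (m ℕ.+ m ℕ.∸ i)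
      mirror {i} i<m = isUnit-mirror {suc i} {m ℕ.+ m ℕ.∸ i} (≡.trans (pairs-mirror i<m) (≡.sym n≡2m+1))


  half-odd : p ≢ 2 → p ℕ.∸ 1 ≡ (p ℕ.∸ 1) / 2 ℕ.+ (p ℕ.∸ 1) / 2
  half-odd p≢2 = ≡.trans p-1≡h+h (≡.cong (λ x → x ℕ.+ x) (≡.sym h≡))
    where
    p-1≡h+h : p ℕ.∸ 1 ≡ p / 2 ℕ.+ p / 2
    p-1≡h+h = ≡.cong (ℕ._∸ 1) (odd⇒suc[h+h] p (prime≢2⇒odd p≢2))
    h≡ : (p ℕ.∸ 1) / 2 ≡ p / 2
    h≡ = ≡.trans (≡.cong (_/ 2) (≡.trans p-1≡h+h (≡.trans (≡.cong (p / 2 ℕ.+_) (≡.sym (ℕP.+-identityʳ (p / 2)))) (ℕP.*-comm 2 (p / 2)))))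
                 (m*n/n≡m (p / 2) 2)

  count-pairs-of-units : p ≢ 2 → ∀ K {m} → p ℕ.^ suc K ≡ suc (m ℕ.+ m) →
    count m (Units.isUnit K ∘ suc) ≡ p ℕ.^ K ℕ.* ((p ℕ.∸ 1) / 2)
  count-pairs-of-units p≢2 K {m} n≡2m+1 = ℕP.*-cancelˡ-≡ c (p ℕ.^ K ℕ.* h) 2 (begin
    2 ℕ.* c                                 ≡⟨ double c ⟩
    c ℕ.+ c                                 ≡⟨ count-half-units {m} n≡2m+1 ⟩
    count (p ℕ.^ suc K) isUnit              ≡⟨ count-units ⟩
    p ℕ.^ K ℕ.* (p ℕ.∸ 1)                   ≡⟨ ≡.cong (p ℕ.^ K ℕ.*_) (half-odd p≢2) ⟩
    p ℕ.^ K ℕ.* (h ℕ.+ h)                   ≡⟨ ℕP.*-distribˡ-+ (p ℕ.^ K) h h ⟩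
    p ℕ.^ K ℕ.* h ℕ.+ p ℕ.^ K ℕ.* h         ≡⟨ double (p ℕ.^ K ℕ.* h) ⟨
    2 ℕ.* (p ℕ.^ K ℕ.* h)                   ∎)
    where
    open ≡.≡-Reasoning
    open Units K
    h c : ℕ
    h = (p ℕ.∸ 1) / 2
    c = count m (isUnit ∘ suc)
    double : ∀ x → 2 ℕ.* x ≡ x ℕ.+ x
    double x = ≡.cong (x ℕ.+_) (ℕP.+-identityʳ x)

-- A record rather than _≈P_ itself, so that P and Q can be inferred from a proof of P ≋ Q.
infix 4 _≋_
record _≋_ (P Q : Poly) : Set where
  constructor mk≋
  field coeff-≡ : P ≈P Q
open _≋_ public

≋-refl : ∀ {P} → P ≋ P
≋-refl = mk≋ λ _ → ≡.refl

≋-reflexive : ∀ {P Q} → P ≡ Q → P ≋ Q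
≋-reflexive ≡.refl = ≋-refl

≋-sym : ∀ {P Q} → P ≋ Q → Q ≋ P
≋-sym (mk≋ e) = mk≋ λ i → ≡.sym (e i)

≋-trans : ∀ {P Q R} → P ≋ Q → Q ≋ R → P ≋ R
≋-trans (mk≋ e) (mk≋ f) = mk≋ λ i → ≡.trans (e i) (f i)

coeff-+P : ∀ P Q i → coeff (P +P Q) i ≡ coeff P i ℤ.+ coeff Q i
coeff-+P []      Q       i       = ≡.sym (ℤP.+-identityˡ _)
coeff-+P (a ∷ P) []      i       = ≡.sym (ℤP.+-identityʳ _)
coeff-+P (a ∷ P) (b ∷ Q) zero    = ≡.refl
coeff-+P (a ∷ P) (b ∷ Q) (suc i) = coeff-+P P Q i

coeff-·P : ∀ c Q i → coeff (c ·P Q) i ≡ c ℤ.* coeff Q i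
coeff-·P c []      i       = ≡.sym (ℤP.*-zeroʳ c)
coeff-·P c (a ∷ Q) zero    = ≡.refl
coeff-·P c (a ∷ Q) (suc i) = coeff-·P c Q i

shift : Poly → Poly
shift P = + 0 ∷ P

-P_ : Poly → Poly
-P P = ℤ.- + 1 ·P P

1P : Poly
1P = + 1 ∷ []

+P-cong : ∀ {P P′ Q Q′} → P ≋ P′ → Q ≋ Q′ → P +P Q ≋ P′ +P Q′
+P-cong {P} {P′} {Q} {Q′} (mk≋ e) (mk≋ f) = mk≋ λ i →
  ≡.trans (coeff-+P P Q i) (≡.trans (≡.cong₂ ℤ._+_ (e i) (f i)) (≡.sym (coeff-+P P′ Q′ i)))

·P-cong : ∀ c {Q Q′} → Q ≋ Q′ → c ·P Q ≋ c ·P Q′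
·P-cong c {Q} {Q′} (mk≋ e) = mk≋ λ i → ≡.trans (coeff-·P c Q i) (≡.trans (≡.cong (c ℤ.*_) (e i)) (≡.sym (coeff-·P c Q′ i)))

shift-cong : ∀ {P Q} → P ≋ Q → shift P ≋ shift Q
shift-cong (mk≋ e) = mk≋ λ { zero → ≡.refl ; (suc i) → e i }

+P-comm : ∀ P Q → P +P Q ≋ Q +P P
+P-comm P Q = mk≋ λ i → ≡.trans (coeff-+P P Q i) (≡.trans (ℤP.+-comm (coeff P i) (coeff Q i)) (≡.sym (coeff-+P Q P i)))

+P-assoc : ∀ P Q R → (P +P Q) +P R ≋ P +P (Q +P R)
+P-assoc P Q R = mk≋ λ i → begin
  coeff ((P +P Q) +P R) i                   ≡⟨ ≡.trans (coeff-+P (P +P Q) R i) (≡.cong (ℤ._+ coeff R i) (coeff-+P P Q i)) ⟩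
  coeff P i ℤ.+ coeff Q i ℤ.+ coeff R i     ≡⟨ ℤP.+-assoc (coeff P i) _ _ ⟩
  coeff P i ℤ.+ (coeff Q i ℤ.+ coeff R i)   ≡⟨ ≡.sym (≡.trans (coeff-+P P (Q +P R) i) (≡.cong (ℤ._+_ (coeff P i)) (coeff-+P Q R i))) ⟩
  coeff (P +P (Q +P R)) i                   ∎
  where open ≡.≡-Reasoning

+P-identityʳ : ∀ P → P +P [] ≋ P
+P-identityʳ []      = ≋-refl
+P-identityʳ (a ∷ P) = ≋-refl

-P-inverseˡ : ∀ P → (-P P) +P P ≋ []
-P-inverseˡ P = mk≋ λ i → ≡.trans (coeff-+P (-P P) P i)
  (≡.trans (≡.cong (ℤ._+ coeff P i) (≡.trans (coeff-·P (ℤ.- + 1) P i) (ℤP.-1*i≡-i (coeff P i)))) (ℤP.+-inverseˡ (coeff P i)))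

-P-inverseʳ : ∀ P → P +P (-P P) ≋ []
-P-inverseʳ P = ≋-trans (+P-comm P (-P P)) (-P-inverseˡ P)

+P-interchange : ∀ A B C D → (A +P B) +P (C +P D) ≋ (A +P C) +P (B +P D)
+P-interchange A B C D = mk≋ λ i → ≡.trans (coeff-+P (A +P B) _ i)
  (≡.trans (≡.cong₂ ℤ._+_ (coeff-+P A B i) (coeff-+P C D i))
  (≡.trans (interchange (coeff A i) (coeff B i) (coeff C i) (coeff D i))
  (≡.sym (≡.trans (coeff-+P (A +P C) _ i) (≡.cong₂ ℤ._+_ (coeff-+P A C i) (coeff-+P B D i))))))
  where open import Algebra.Properties.CommutativeSemigroup ℤP.+-commutativeSemigroup using (interchange)

shift-[] : shift [] ≋ []
shift-[] = mk≋ λ { zero → ≡.refl ; (suc i) → ≡.refl }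

·P-+P : ∀ c P Q → c ·P (P +P Q) ≋ c ·P P +P c ·P Q
·P-+P c P Q = mk≋ λ i → ≡.trans (coeff-·P c (P +P Q) i) (≡.trans (≡.cong (c ℤ.*_) (coeff-+P P Q i))
  (≡.trans (ℤP.*-distribˡ-+ c (coeff P i) _) (≡.sym (≡.trans (coeff-+P (c ·P P) (c ·P Q) i) (≡.cong₂ ℤ._+_ (coeff-·P c P i) (coeff-·P c Q i))))))

·P-·P : ∀ c d P → c ·P (d ·P P) ≋ (c ℤ.* d) ·P P
·P-·P c d P = mk≋ λ i → ≡.trans (coeff-·P c (d ·P P) i)
  (≡.trans (≡.cong (c ℤ.*_) (coeff-·P d P i)) (≡.trans (≡.sym (ℤP.*-assoc c d (coeff P i))) (≡.sym (coeff-·P (c ℤ.* d) P i))))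

+-·P : ∀ c d P → (c ℤ.+ d) ·P P ≋ c ·P P +P d ·P P
+-·P c d P = mk≋ λ i → ≡.trans (coeff-·P (c ℤ.+ d) P i)
  (≡.trans (ℤP.*-distribʳ-+ (coeff P i) c d) (≡.sym (≡.trans (coeff-+P (c ·P P) _ i) (≡.cong₂ ℤ._+_ (coeff-·P c P i) (coeff-·P d P i)))))

0·P : ∀ Q → + 0 ·P Q ≋ []
0·P Q = mk≋ (coeff-·P (+ 0) Q)

·P-shift : ∀ c P → c ·P shift P ≋ shift (c ·P P)
·P-shift c P = mk≋ λ { zero → ℤP.*-zeroʳ c ; (suc i) → ≡.refl }

*P-zeroʳ : ∀ P → P *P [] ≋ []
*P-zeroʳ []      = ≋-refl
*P-zeroʳ (a ∷ P) = ≋-trans (shift-cong (*P-zeroʳ P)) shift-[]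

*P-congʳ : ∀ P {Q Q′} → Q ≋ Q′ → P *P Q ≋ P *P Q′
*P-congʳ []      e = ≋-refl
*P-congʳ (a ∷ P) e = +P-cong (·P-cong a e) (shift-cong (*P-congʳ P e))

*P-distribʳ : ∀ P Q R → (P +P Q) *P R ≋ P *P R +P Q *P R
*P-distribʳ []      Q       R = ≋-refl
*P-distribʳ (a ∷ P) []      R = ≋-sym (+P-identityʳ _)
*P-distribʳ (a ∷ P) (b ∷ Q) R =
  ≋-trans (+P-cong (+-·P a b R) (shift-cong (*P-distribʳ P Q R)))
          (+P-interchange (a ·P R) (b ·P R) (shift (P *P R)) (shift (Q *P R)))

*P-distribˡ : ∀ R P Q → R *P (P +P Q) ≋ R *P P +P R *P Q
*P-distribˡ []      P Q = ≋-refl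
*P-distribˡ (a ∷ R) P Q =
  ≋-trans (+P-cong (·P-+P a P Q) (shift-cong (*P-distribˡ R P Q)))
          (+P-interchange (a ·P P) (a ·P Q) (shift (R *P P)) (shift (R *P Q)))

*P-shiftʳ : ∀ P Q → P *P shift Q ≋ shift (P *P Q)
*P-shiftʳ []      Q = ≋-sym shift-[]
*P-shiftʳ (a ∷ P) Q = +P-cong (·P-shift a Q) (shift-cong (*P-shiftʳ P Q))

*P-constʳ : ∀ P b → P *P (b ∷ []) ≋ b ·P P
*P-constʳ []      b = ≋-refl
*P-constʳ (a ∷ P) b = mk≋ λ { zero → ≡.trans (ℤP.+-identityʳ _) (ℤP.*-comm a b) ; (suc i) → coeff-≡ (*P-constʳ P b) i }

*P-comm : ∀ P Q → P *P Q ≋ Q *P P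
*P-comm P []      = *P-zeroʳ P
*P-comm P (b ∷ Q) =
  ≋-trans (*P-congʳ P (mk≋ λ { zero → ≡.sym (ℤP.+-identityʳ b) ; (suc i) → ≡.refl }))
  (≋-trans (*P-distribˡ P (b ∷ []) (shift Q))
  (+P-cong (*P-constʳ P b) (≋-trans (*P-shiftʳ P Q) (shift-cong (*P-comm P Q)))))

*P-cong : ∀ {P P′ Q Q′} → P ≋ P′ → Q ≋ Q′ → P *P Q ≋ P′ *P Q′
*P-cong {P} {P′} {Q} {Q′} e f = ≋-trans (*P-comm P Q) (≋-trans (*P-congʳ Q e) (≋-trans (*P-comm Q P′) (*P-congʳ P′ f)))

·P-*P : ∀ c P Q → (c ·P P) *P Q ≋ c ·P (P *P Q)
·P-*P c []      Q = ≋-refl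
·P-*P c (a ∷ P) Q = ≋-trans (+P-cong (≋-sym (·P-·P c a Q)) (≋-trans (shift-cong (·P-*P c P Q)) (≋-sym (·P-shift c (P *P Q)))))
  (≋-sym (·P-+P c (a ·P Q) (shift (P *P Q))))

*P-assoc : ∀ P Q R → (P *P Q) *P R ≋ P *P (Q *P R)
*P-assoc []      Q R = ≋-refl
*P-assoc (a ∷ P) Q R =
  ≋-trans (*P-distribʳ (a ·P Q) (shift (P *P Q)) R)
  (+P-cong (·P-*P a Q R) (≋-trans (+P-cong (0·P R) ≋-refl) (shift-cong (*P-assoc P Q R))))

*P-identityˡ : ∀ P → 1P *P P ≋ P
*P-identityˡ P = mk≋ λ i → ≡.trans (coeff-+P (+ 1 ·P P) (shift []) i)
  (≡.trans (≡.cong₂ ℤ._+_ (≡.trans (coeff-·P (+ 1) P i) (ℤP.*-identityˡ _)) (coeff-≡ shift-[] i)) (ℤP.+-identityʳ _))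

xpow-+ : ∀ a b → xpow a *P xpow b ≋ xpow (a ℕ.+ b)
xpow-+ zero    b = *P-identityˡ (xpow b)
xpow-+ (suc a) b = ≋-trans (+P-cong (0·P (xpow b)) ≋-refl) (shift-cong (xpow-+ a b))

0∷[]+P : ∀ Q → (+ 0 ∷ []) +P Q ≋ Q
0∷[]+P Q = mk≋ λ i → ≡.trans (coeff-+P (+ 0 ∷ []) Q i) (≡.trans (≡.cong (ℤ._+ coeff Q i) (coeff-0 i)) (ℤP.+-identityˡ _))
  where
  coeff-0 : ∀ i → coeff (+ 0 ∷ []) i ≡ + 0
  coeff-0 zero    = ≡.refl
  coeff-0 (suc i) = ≡.refl

substPow-+P : ∀ j P Q → substPow j (P +P Q) ≋ substPow j P +P substPow j Q
substPow-+P j []      Q       = ≋-refl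
substPow-+P j (a ∷ P) []      = ≋-sym (+P-identityʳ _)
substPow-+P j (a ∷ P) (b ∷ Q) =
  ≋-trans (+P-cong ≋-refl (≋-trans (*P-congʳ (xpow j) (substPow-+P j P Q)) (*P-distribˡ (xpow j) _ _)))
          (+P-interchange (a ∷ []) (b ∷ []) (xpow j *P substPow j P) (xpow j *P substPow j Q))

substPow-sumP : ∀ j (f : ℕ → Poly) xs → substPow j (sumP (map f xs)) ≋ sumP (map (substPow j ∘ f) xs)
substPow-sumP j f []       = ≋-refl
substPow-sumP j f (x ∷ xs) = ≋-trans (substPow-+P j (f x) _) (+P-cong ≋-refl (substPow-sumP j f xs))

substPow-xpow : ∀ j e → substPow j (xpow e) ≋ xpow (j ℕ.* e)
substPow-xpow j zero    = ≋-trans (+P-cong ≋-refl (*P-zeroʳ (xpow j))) (≋-reflexive (≡.cong xpow (≡.sym (ℕP.*-zeroʳ j))))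
substPow-xpow j (suc e) = ≋-trans (0∷[]+P _) (≋-trans (*P-congʳ (xpow j) (substPow-xpow j e))
  (≋-trans (xpow-+ j (j ℕ.* e)) (≋-reflexive (≡.cong xpow (≡.sym (ℕP.*-suc j e))))))

ℤ[x] : CommutativeRing 0ℓ 0ℓ
ℤ[x] = record { isCommutativeRing = isCommutativeRing }
  where
  isCommutativeRing : IsCommutativeRing _≋_ _+P_ _*P_ -P_ [] 1P
  isCommutativeRing = record
    { isRing = record
      { +-isAbelianGroup = record
        { isGroup = record
          { isMonoid = record
            { isSemigroup = record
              { isMagma = record
                { isEquivalence = record { refl = ≋-refl ; sym = ≋-sym ; trans = ≋-trans }
                ; ∙-cong = +P-cong }
              ; assoc = +P-assoc }
            ; identity = (λ _ → ≋-refl) , +P-identityʳ }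
          ; inverse = -P-inverseˡ , -P-inverseʳ
          ; ⁻¹-cong = ·P-cong (ℤ.- + 1) }
        ; comm = +P-comm }
      ; *-cong = *P-cong
      ; *-assoc = *P-assoc
      ; *-identity = *P-identityˡ , (λ P → ≋-trans (*P-comm P 1P) (*P-identityˡ P))
      ; distrib = *P-distribˡ , (λ R P Q → *P-distribʳ P Q R) }
    ; *-comm = *P-comm }

-- The ring solver compares normal forms definitionally, so it must be able to detect zero coefficients.
[]≋? : ∀ P → Maybe ([] ≋ P)
[]≋? []      = just ≋-refl
[]≋? (a ∷ P) with a ℤ.≟ + 0 | []≋? P
... | yes ≡.refl | just (mk≋ e) = just (mk≋ λ { zero → ≡.refl ; (suc i) → e i })
... | _        | _            = nothing

module Quotient (M : Poly) where
  open RingSolver (fromCommutativeRing ℤ[x] []≋?) using (solve; _⊜_; _⊕_; _⊗_; ⊝_)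

  infix 4 _∼_
  record _∼_ (P Q : Poly) : Set where
    constructor ∼-intro
    field
      quotient : Poly
      ≋+M* : P ≋ Q +P M *P quotient

  lift : ∀ {P Q} → P ≋ Q → P ∼ Q
  lift {P} {Q} e = ∼-intro [] (≋-trans e (≋-trans (≋-sym (+P-identityʳ Q)) (+P-cong ≋-refl (≋-sym (*P-zeroʳ M)))))

  M∼0 : M ∼ []
  M∼0 = ∼-intro 1P (≋-sym (≋-trans (*P-comm M 1P) (*P-identityˡ M)))

  private
    ∼-sym : ∀ {P Q} → P ∼ Q → Q ∼ P
    ∼-sym {P} {Q} (∼-intro q e) = ∼-intro (-P q) (≋-trans (≋-sym (solve 4 (λ P Q M q → ((Q ⊕ M ⊗ q) ⊕ M ⊗ (⊝ q)) ⊜ Q) ≋-refl P Q M q))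
                                           (+P-cong (≋-sym e) ≋-refl))

    ∼-trans : ∀ {P Q R} → P ∼ Q → Q ∼ R → P ∼ R
    ∼-trans {P} {Q} {R} (∼-intro q₁ e₁) (∼-intro q₂ e₂) = ∼-intro (q₂ +P q₁)
      (≋-trans e₁ (≋-trans (+P-cong e₂ ≋-refl)
        (solve 4 (λ R M q₁ q₂ → ((R ⊕ M ⊗ q₂) ⊕ M ⊗ q₁) ⊜ (R ⊕ M ⊗ (q₂ ⊕ q₁))) ≋-refl R M q₁ q₂)))

    +-cong : ∀ {P P′ Q Q′} → P ∼ P′ → Q ∼ Q′ → P +P Q ∼ P′ +P Q′
    +-cong {P} {P′} {Q} {Q′} (∼-intro q₁ e₁) (∼-intro q₂ e₂) = ∼-intro (q₁ +P q₂)
      (≋-trans (+P-cong e₁ e₂)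
        (solve 5 (λ P Q M q₁ q₂ → ((P ⊕ M ⊗ q₁) ⊕ (Q ⊕ M ⊗ q₂)) ⊜ ((P ⊕ Q) ⊕ M ⊗ (q₁ ⊕ q₂))) ≋-refl P′ Q′ M q₁ q₂))

    *-cong : ∀ {P P′ Q Q′} → P ∼ P′ → Q ∼ Q′ → P *P Q ∼ P′ *P Q′
    *-cong {P} {P′} {Q} {Q′} (∼-intro q₁ e₁) (∼-intro q₂ e₂) = ∼-intro (q₁ *P Q′ +P (P′ *P q₂ +P M *P (q₁ *P q₂)))
      (≋-trans (*P-cong e₁ e₂)
        (solve 5 (λ P Q M q₁ q₂ → ((P ⊕ M ⊗ q₁) ⊗ (Q ⊕ M ⊗ q₂)) ⊜ (P ⊗ Q ⊕ M ⊗ (q₁ ⊗ Q ⊕ (P ⊗ q₂ ⊕ M ⊗ (q₁ ⊗ q₂)))))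
               ≋-refl P′ Q′ M q₁ q₂))

    -‿cong : ∀ {P P′} → P ∼ P′ → -P P ∼ -P P′
    -‿cong {P} {P′} (∼-intro q e) = ∼-intro (-P q)
      (≋-trans (·P-cong (ℤ.- + 1) e) (solve 3 (λ P M q → (⊝ (P ⊕ M ⊗ q)) ⊜ ((⊝ P) ⊕ M ⊗ (⊝ q))) ≋-refl P′ M q))

  quotientRing : CommutativeRing 0ℓ 0ℓ
  quotientRing = record { isCommutativeRing = isCommutativeRing }
    where
    isCommutativeRing : IsCommutativeRing _∼_ _+P_ _*P_ -P_ [] 1P
    isCommutativeRing = record
      { isRing = record
        { +-isAbelianGroup = record
          { isGroup = record
            { isMonoid = record
              { isSemigroup = record
                { isMagma = record
                  { isEquivalence = record { refl = lift ≋-refl ; sym = ∼-sym ; trans = ∼-trans }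
                  ; ∙-cong = +-cong }
                ; assoc = λ P Q R → lift (+P-assoc P Q R) }
              ; identity = (λ P → lift ≋-refl) , (λ P → lift (+P-identityʳ P)) }
            ; inverse = (λ P → lift (-P-inverseˡ P)) , (λ P → lift (-P-inverseʳ P))
            ; ⁻¹-cong = -‿cong }
          ; comm = λ P Q → lift (+P-comm P Q) }
        ; *-cong = *-cong
        ; *-assoc = λ P Q R → lift (*P-assoc P Q R)
        ; *-identity = (λ P → lift (*P-identityˡ P)) , (λ P → lift (≋-trans (*P-comm P 1P) (*P-identityˡ P)))
        ; distrib = (λ R P Q → lift (*P-distribˡ R P Q)) , (λ R P Q → lift (*P-distribʳ P Q R)) }
      ; *-comm = λ P Q → lift (*P-comm P Q) }

module CyclotomicNorm {p : ℕ} (p-prime : Prime p) (p≢2 : p ≢ 2) (K : ℕ) where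
  open Quotient (cyclotomicPP p (suc K))
  open CommutativeRing quotientRing
  open RingSums quotientRing
  open RootsOfUnity quotientRing
  open GaussSums quotientRing p-prime p≢2
  open Units p-prime K
  open import Data.Integer.Divisibility.Signed using (_∣_; divides; ∣⇒∣ᵤ)
  open import Relation.Binary.Reasoning.Setoid setoid

  private
    n : ℕ
    n = p ℕ.^ suc K
    instance _ = ℕP.m^n≢0 p (suc K)

  X : Poly
  X = xpow 1

  xpow≈X^ : ∀ e → xpow e ≈ X ^ e
  xpow≈X^ zero    = refl
  xpow≈X^ (suc e) = trans (lift (≋-sym (xpow-+ 1 e))) (*-cong {X} {X} {xpow e} {X ^ e} refl (xpow≈X^ e))

  ι≈const : ∀ m → ι m ≈ (+ m ∷ [])
  ι≈const zero    = lift (mk≋ λ { zero → ≡.refl ; (suc i) → ≡.refl })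
  ι≈const (suc m) = trans (+-cong {1P} {1P} {ι m} refl (ι≈const m)) (lift (mk≋ λ { zero → ≡.sym (ℤP.pos-+ 1 m) ; (suc i) → ≡.refl }))

  X-root : RootOfΦ (suc K) X
  X-root = begin
    Σ p (λ i → X ^ (i ℕ.* p ℕ.^ K))     ≈⟨ Σ-cong p (λ i → sym (xpow≈X^ (i ℕ.* p ℕ.^ K))) ⟩
    Σ p (λ i → xpow (i ℕ.* p ℕ.^ K))    ≈⟨ Σ-applyUpTo (λ i → xpow (i ℕ.* p ℕ.^ K)) id p ⟨
    cyclotomicPP p (suc K)              ≈⟨ M∼0 ⟩
    []                                  ∎

  conjugate : ∀ j g → substPow j (expSum p (suc K) g) ≈ gaussSum n X (λ t → + j ℤ.* g t)
  conjugate j g = begin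
    substPow j (sumP (map f (upTo n)))          ≈⟨ lift (substPow-sumP j f (upTo n)) ⟩
    sumP (map (substPow j ∘ f) (upTo n))        ≈⟨ Σ-applyUpTo (substPow j ∘ f) id n ⟩
    Σ n (λ t → substPow j (f t))                ≈⟨ Σ-cong n (λ t → trans (lift (substPow-xpow j _)) (xpow≈X^ _)) ⟩
    Σ n (λ t → X ^ (j ℕ.* modN (g (+ t)) n))    ≈⟨ Σ-cong n (λ t → sym (scaled-exponent (g (+ t)))) ⟩
    Σ n (λ t → X ^[ n ] (+ j ℤ.* g (+ t)))      ∎
    where
    f : ℕ → Poly
    f t = xpow (modN (g (+ t)) n)
    scaled-exponent : ∀ z → X ^[ n ] (+ j ℤ.* z) ≈ X ^ (j ℕ.* modN z n)
    scaled-exponent z = trans (^[]-cong (mod-trans (mod-*ˡ (+ j) (modN-correct n z)) (mod-reflexive (≡.sym (ℤP.pos-* j (modN z n))))))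
                              (^[]-pos (root⇒^≈1 (suc K) X-root) (j ℕ.* modN z n))

  private
    conj : (ℤ → ℤ) → ℕ → Poly
    conj g j = substPow j (expSum p (suc K) g)

  conjugate-pair : ∀ {g} → QuadraticPhase p g → ∀ {j j′} → j ℕ.+ j′ ≡ n →
    (if isUnit j then conj g j else 1P) * (if isUnit j′ then conj g j′ else 1P) ≈ (if isUnit j then ι n else 1#)
  conjugate-pair {g} G {j} {j′} j+j′≡n with isUnit j in uj | isUnit j′ in uj′
  ... | true  | true  = begin
    conj g j * conj g j′
      ≈⟨ *-cong (conjugate j g) (conjugate j′ g) ⟩
    gaussSum n X (λ t → + j ℤ.* g t) * gaussSum n X (λ t → + j′ ℤ.* g t)
      ≈⟨ *-cong (refl {gaussSum n X (λ t → + j ℤ.* g t)}) (Σ-cong n (λ t → ^[]-cong (complement (g (+ t))))) ⟩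
    gaussSum n X (λ t → + j ℤ.* g t) * gaussSum n X (λ t → ℤ.- (+ j ℤ.* g t))
      ≈⟨ gaussSum-norm (suc K) X-root (phase-* G p-prime (+ j) p∤j) ⟩
    ι n
      ∎
    where
    p∤j : ¬ + p ∣ + j
    p∤j p∣j with () ← ≡.trans (≡.sym uj) (isUnit-∣ {j} (∣⇒∣ᵤ p∣j))
    complement : ∀ x → + j′ ℤ.* x ≡ ℤ.- (+ j ℤ.* x) mod n
    complement x = mod-intro (divides x (≡.trans (regroup (+ j) (+ j′) x)
      (≡.cong (x ℤ.*_) (≡.trans (≡.sym (ℤP.pos-+ j j′)) (≡.cong +_ j+j′≡n)))))
      where
      regroup : ∀ j j′ x → j′ ℤ.* x ℤ.- ℤ.- (j ℤ.* x) ≡ x ℤ.* (j ℤ.+ j′)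
      regroup = solve-∀
  ... | false | false = *-identityˡ 1P
  ... | true  | false with () ← ≡.trans (≡.sym uj) (≡.trans (isUnit-mirror {j} {j′} j+j′≡n) uj′)
  ... | false | true  with () ← ≡.trans (≡.sym uj′) (≡.trans (≡.sym (isUnit-mirror {j} {j′} j+j′≡n)) uj)

  -- 0 is not a unit and j ↦ n − j pairs off the units, so the norm is n ^ (φ(n)/2).
  normProd-phase : ∀ {g} → QuadraticPhase p g →
    normProd n (expSum p (suc K) g) ≈ (+ (p ℕ.^ (suc K ℕ.* ((p ℕ.∸ 1) / 2) ℕ.* p ℕ.^ K)) ∷ [])
  normProd-phase {g} G = begin
    normProd n (expSum p (suc K) g)                              ≈⟨ Π-filter isUnit (conj g) id n ⟩
    Π n H                                                        ≡⟨ ≡.cong (λ N → Π N H) n≡2m+1 ⟩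
    Π (suc (m ℕ.+ m)) H                                          ≈⟨ Π-pairs m H ⟩
    H 0 * Π m (λ i → H (suc i) * H (m ℕ.+ m ℕ.∸ i))              ≈⟨ *-cong (reflexive (≡.cong (if_then conj g 0 else 1P) isUnit-0))
                                                                          (Π-cong< m (λ i i<m → conjugate-pair G {suc i} (mirror i<m))) ⟩
    1P * Π m (λ i → if isUnit (suc i) then ι n else 1#)          ≈⟨ trans (*-identityˡ _) (Π-if m (isUnit ∘ suc) (ι n)) ⟩
    ι n ^ count m (isUnit ∘ suc)                                 ≈⟨ ι-^ n (count m (isUnit ∘ suc)) ⟨
    ι (n ℕ.^ count m (isUnit ∘ suc))                             ≡⟨ ≡.cong ι exponent ⟩
    ι (p ℕ.^ (suc K ℕ.* ((p ℕ.∸ 1) / 2) ℕ.* p ℕ.^ K))            ≈⟨ ι≈const _ ⟩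
    + (p ℕ.^ (suc K ℕ.* ((p ℕ.∸ 1) / 2) ℕ.* p ℕ.^ K)) ∷ []       ∎
    where
    H : ℕ → Poly
    H j = if isUnit j then conj g j else 1P
    m : ℕ
    m = n / 2
    n≡2m+1 : n ≡ suc (m ℕ.+ m)
    n≡2m+1 = odd⇒suc[h+h] n (^-odd {p} (prime≢2⇒odd p-prime p≢2) (suc K))
    mirror : ∀ {i} → i ℕ.< m → suc i ℕ.+ (m ℕ.+ m ℕ.∸ i) ≡ n
    mirror i<m = ≡.trans (pairs-mirror i<m) (≡.sym n≡2m+1)
    exponent : n ℕ.^ count m (isUnit ∘ suc) ≡ p ℕ.^ (suc K ℕ.* ((p ℕ.∸ 1) / 2) ℕ.* p ℕ.^ K)
    exponent = ≡.trans (ℕP.^-*-assoc p (suc K) (count m (isUnit ∘ suc)))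
      (≡.cong (p ℕ.^_) (≡.trans (≡.cong (suc K ℕ.*_) (count-pairs-of-units p-prime p≢2 K {m} n≡2m+1))
                                (rearrange (suc K) (p ℕ.^ K) ((p ℕ.∸ 1) / 2))))
      where
      rearrange : ∀ k q h → k ℕ.* (q ℕ.* h) ≡ k ℕ.* h ℕ.* q
      rearrange = ℕSolver.solve-∀

  isNormPP-phase : ∀ {g} → QuadraticPhase p g →
    IsNormPP p (suc K) (expSum p (suc K) g) (+ (p ℕ.^ (suc K ℕ.* ((p ℕ.∸ 1) / 2) ℕ.* p ℕ.^ K)))
  isNormPP-phase G = let ∼-intro q e = normProd-phase G in q , coeff-≡ e

isNormPP-level-zero : ∀ p g → IsNormPP p 0 (expSum p 0 g) (+ 1)
isNormPP-level-zero p g = [] , coeff-≡ (≋-trans level-zero (≋-sym (+P-cong {1P} ≋-refl (*P-zeroʳ (cyclotomicPP p 0)))))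
  where
  f : ℕ → Poly
  f t = xpow (modN (g (+ t)) 1)
  level-zero : normProd 1 (expSum p 0 g) ≋ 1P
  level-zero = ≋-trans (*P-comm _ 1P) (≋-trans (*P-identityˡ _) (≋-trans (substPow-sumP 0 f (upTo 1))
    (≋-trans (+P-identityʳ _) (substPow-xpow 0 (modN (g (+ 0)) 1)))))

phase-isNormPP : ∀ {p} → Prime p → p ≢ 2 → ∀ k {g} → QuadraticPhase p g →
  IsNormPP p k (expSum p k g) (+ (p ℕ.^ (k ℕ.* ((p ℕ.∸ 1) ℕ./ 2) ℕ.* p ℕ.^ (k ℕ.∸ 1))))
phase-isNormPP {p} p-prime p≢2 zero    {g} _ = isNormPP-level-zero p g
phase-isNormPP     p-prime p≢2 (suc K)     G = CyclotomicNorm.isNormPP-phase p-prime p≢2 K G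

open import Data.Integer.Divisibility using (_∣_)

proposition5p9 : (p : ℕ) → Prime p → p ≢ 2 → (a b c : ℤ) → (k : ℕ) → ¬ ((+ p) ∣ c) → (f : Poly)
    → IsNormPP p k (expSum p k (λ t → a ℤ.+ b ℤ.* t ℤ.+ c ℤ.* t ℤ.* t ℤ.+ (+ p) ℤ.* evalZ f t)) (+ (p ℕ.^ (k ℕ.* ((p ℕ.∸ 1) ℕ./ 2) ℕ.* p ℕ.^ (k ℕ.∸ 1))))
    × IsNormPP p k (expSum p k (λ t → t ℤ.* t)) (+ (p ℕ.^ (k ℕ.* ((p ℕ.∸ 1) ℕ./ 2) ℕ.* p ℕ.^ (k ℕ.∸ 1))))
proposition5p9 p p-prime p≢2 a b c k p∤c f = phase-isNormPP p-prime p≢2 k quadratic , phase-isNormPP p-prime p≢2 k square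
  where
  quadratic : QuadraticPhase p (λ t → a ℤ.+ b ℤ.* t ℤ.+ c ℤ.* t ℤ.* t ℤ.+ + p ℤ.* evalZ f t)
  quadratic = record { a = a ; b = b ; c = c ; h = f ; p∤c = p∤c ∘ Signed.∣⇒∣ᵤ ; g≗ = λ _ → ≡.refl }
  square : QuadraticPhase p (λ t → t ℤ.* t)
  square = record { a = + 0 ; b = + 0 ; c = + 1 ; h = [] ; p∤c = p∤1 ; g≗ = λ t → as-phase t (+ p) }
    where
    p∤1 : ¬ + p Signed.∣ + 1
    p∤1 p∣1 = ℕP.<⇒≢ (ℕ.nonTrivial⇒n>1 p {{prime⇒nonTrivial p-prime}}) (≡.sym (ℕD.∣1⇒≡1 (Signed.∣⇒∣ᵤ p∣1)))
    as-phase : ∀ t P → t ℤ.* t ≡ + 0 ℤ.+ + 0 ℤ.* t ℤ.+ + 1 ℤ.* t ℤ.* t ℤ.+ P ℤ.* + 0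
    as-phase = solve-∀
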